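{- Let $k\ge1$, $\delta>0$, with $n$ sufficiently large relative to $\ell$. Let $\mathcal{L}\subseteq\mathrm{Grass}(n,2\ell)$ and $\mathcal{R}\subseteq\mathrm{Grass}(n,2(1-\delta)\ell)$, and define $F:\mathbb{F}_2^{n\times2\ell}\to\{0,1\}$ by $F(M')=1$ iff $\mathrm{im}(M')\in\mathcal{L}$, and $G:\mathbb{F}_2^{n\times2(1-\delta)\ell}\to\{0,1\}$ by $G(M)=1$ iff $\mathrm{im}(M)\in\mathcal{R}$. Then \[\Pr_{R;L_1,\dots,L_k\supseteq R}[R\in\mathcal{R},L_1,\dots,L_k\in\mathcal{L}]\le 2\langle(\mathcal{T}F)^k,G\rangle,\] where $R$ is uniform in $\mathrm{Grass}(n,2(1-\delta)\ell)$ and the $L_i$ are independent uniform in $\mathrm{Grass}(n,2\ell)$ conditioned on $L_i\supseteq R$.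
   Context: $\mathrm{im}(M)$ is the column span of $M$ (so $F(M')=0$ if the columns of $M'$ are dependent, similarly for $G$). For functions on $\mathbb{F}_2^{n\times m}$, $\langle F,G\rangle=\mathbb{E}_M[F(M)\overline{G(M)}]$ with $M$ uniform. The operator $\mathcal{T}:L_2(\mathbb{F}_2^{n\times2\ell})\to L_2(\mathbb{F}_2^{n\times2(1-\delta)\ell})$ is $\mathcal{T}F(M)=\mathbb{E}_{v_1,\dots,v_{2\delta\ell}}[F([M,v_1,\dots,v_{2\delta\ell}])]$, where the $v_j\in\mathbb{F}_2^n$ are uniform and independent and $[M,v_1,\dots]$ appends them as columns. $\mathrm{Grass}(n,m)$ is the set of $m$-dimensional subspaces of $\mathbb{F}_2^n$. -}

module Defs where

open import Data.Bool using (Bool; true; false; _∧_; _∨_; _xor_; not; if_then_else_)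
open import Data.Nat using (ℕ; zero; suc; _∸_)
open import Data.Integer using (+_)
open import Data.Rational using (ℚ; 0ℚ; 1ℚ; _+_; _*_; _/_)
open import Data.List using (List; []; _∷_; length; filter; map; foldr; concatMap)
open import Data.Bool.ListAction using (any; all)
open import Data.Vec using (Vec; []; _∷_; _++_; zipWith; replicate)
import Data.Vec.Properties as VP
import Data.Bool.Properties as BP
open import Data.Product using (_×_; _,_)
open import Relation.Nullary.Decidable using (⌊_⌋)
open import Relation.Binary.PropositionalEquality using (_≡_)

-- Vectors of F₂ⁿ (Bool = F₂, xor = addition)

Pt : ℕ → Set
Pt n = Vec Bool n

allPts : (n : ℕ) → List (Pt n)
allPts zero    = [] ∷ []
allPts (suc n) = concatMap (λ v → (false ∷ v) ∷ (true ∷ v) ∷ []) (allPts n)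

zeroPt : (n : ℕ) → Pt n
zeroPt n = replicate n false

_⊕_ : ∀ {n} → Pt n → Pt n → Pt n
_⊕_ = zipWith _xor_

_==_ : ∀ {n} → Pt n → Pt n → Bool
x == y = ⌊ VP.≡-dec BP._≟_ x y ⌋

-- Subsets of F₂ⁿ, represented canonically by their characteristic
-- function stored as a complete binary tree (so equal sets are equal terms).

PSet : ℕ → Set
PSet zero    = Bool
PSet (suc n) = PSet n × PSet n

mem : ∀ {n} → PSet n → Pt n → Bool
mem {zero}  b       []      = b
mem {suc n} (s , t) (false ∷ x) = mem s x
mem {suc n} (s , t) (true  ∷ x) = mem t x

tab : ∀ {n} → (Pt n → Bool) → PSet n
tab {zero}  f = f []
tab {suc n} f = tab (λ x → f (false ∷ x)) , tab (λ x → f (true ∷ x))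

allPSets : (n : ℕ) → List (PSet n)
allPSets zero    = false ∷ true ∷ []
allPSets (suc n) = concatMap (λ s → map (λ t → s , t) (allPSets n)) (allPSets n)

count : ∀ {n} → PSet n → ℕ
count {n} S = length (filter (λ x → mem S x ≡? true) (allPts n))
  where
  _≡?_ : (a b : Bool) → _
  _≡?_ = BP._≟_

_^ℕ_ : ℕ → ℕ → ℕ
b ^ℕ zero  = 1
b ^ℕ suc e = b Data.Nat.* (b ^ℕ e)

natEq : ℕ → ℕ → Bool
natEq a b = ⌊ a Data.Nat.≟ b ⌋

subsetB : ∀ {n} → PSet n → PSet n → Bool
subsetB {n} S T = all (λ x → not (mem S x) ∨ mem T x) (allPts n)

isGrass : (n m : ℕ) → PSet n → Bool
isGrass n m S =
  mem S (zeroPt n)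
  ∧ all (λ x → all (λ y → not (mem S x ∧ mem S y) ∨ mem S (x ⊕ y)) (allPts n)) (allPts n)
  ∧ natEq (count S) (2 ^ℕ m)

Grass : (n m : ℕ) → List (PSet n)
Grass n m = filter (λ S → isGrass n m S BP.≟ true) (allPSets n)

-- Matrices in F₂^{n×m}, given as the vector of their m columns.

Mat : ℕ → ℕ → Set
Mat n m = Vec (Pt n) m

allMats : (n m : ℕ) → List (Mat n m)
allMats n zero    = [] ∷ []
allMats n (suc m) = concatMap (λ M → map (λ v → v ∷ M) (allPts n)) (allMats n m)

lincomb : ∀ {n m} → Vec Bool m → Mat n m → Pt n
lincomb {n} []       []       = zeroPt n
lincomb (c ∷ cs) (v ∷ M) = if c then v ⊕ lincomb cs M else lincomb cs M

im : ∀ {n m} → Mat n m → PSet n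
im {n} {m} M = tab (λ x → any (λ c → lincomb c M == x) (allPts m))

sumℚ : List ℚ → ℚ
sumℚ = foldr _+_ 0ℚ

-- 𝔼_{a ∈ xs}[f a] for xs uniform; convention 0 for the empty list
-- (never used on empty lists in the statement).
avg : ∀ {A : Set} → List A → (A → ℚ) → ℚ
avg xs f with length xs
... | zero  = 0ℚ
... | suc d = sumℚ (map f xs) * (+ 1 / suc d)

ind : Bool → ℚ
ind true  = 1ℚ
ind false = 0ℚ

_^ℚ_ : ℚ → ℕ → ℚ
q ^ℚ zero  = 1ℚ
q ^ℚ suc e = q * (q ^ℚ e)

-- The objects of the lemma.  L2 = 2ℓ, r = 2(1-δ)ℓ, d = 2δℓ = L2 ∸ r.

Ffun : ∀ {n} → (PSet n → Bool) → ∀ {m} → Mat n m → ℚ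
Ffun 𝓛 M = ind (𝓛 (im M))

TF : ∀ n (L2 r : ℕ) → (PSet n → Bool) → Mat n r → ℚ
TF n L2 r 𝓛 M = avg (allMats n (L2 ∸ r)) (λ V → Ffun 𝓛 (M ++ V))

innerTFkG : ∀ n (L2 r k : ℕ) → (PSet n → Bool) → (PSet n → Bool) → ℚ
innerTFkG n L2 r k 𝓛 𝓡 =
  avg (allMats n r) (λ M → (TF n L2 r 𝓛 M ^ℚ k) * ind (𝓡 (im M)))

-- Pr_{R; L₁..L_k ⊇ R}[R ∈ 𝓡, L₁,…,L_k ∈ 𝓛]
--  = 𝔼_{R ∈ Grass(n,r)} [ 1[R ∈ 𝓡] · (Pr_{L ∈ Grass(n,L2), L ⊇ R}[L ∈ 𝓛])^k ]
probRL : ∀ n (L2 r k : ℕ) → (PSet n → Bool) → (PSet n → Bool) → ℚ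
probRL n L2 r k 𝓛 𝓡 =
  avg (Grass n r) (λ R →
    ind (𝓡 R) * (avg (filter (λ L → subsetB R L BP.≟ true) (Grass n L2)) (λ L → ind (𝓛 L)) ^ℚ k))

twoℚ : ℚ
twoℚ = + 2 / 1

-- Write d = 2ℓ - r.  For an r-dimensional subspace R and an (r+d)-dimensional L ⊇ R, the number
-- of d-tuples V with R + span V = L is B₁ = ∏_{i<d} (2^(r+d) - 2^(r+i)), independent of L; likewise
-- every r-dimensional subspace is the column span of exactly B₀ matrices.  Hence 𝒯F(M) depends only
-- on R = im M and equals B₁·a(R)/2^(nd), where a(R) is the number of members of 𝓛 containing R,
-- while Pr[L ∈ 𝓛 | L ⊇ R] = B₁·a(R)/Γ₁ with Γ₁ the number of d-tuples independent over R.  Both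
-- sides are thus multiples of Σ_{R ∈ 𝓡} (B₁·a(R))^k, and the inequality reduces to
-- 2^(n(r+dk)) ≤ 2·Γ₀·Γ₁^k with Γ₀ the number of independent r-tuples.  Every factor of Γ₀ and Γ₁ is
-- at least 2^n - 2^(2ℓ), so this follows from Bernoulli's inequality once n > 2ℓ + 2(r + dk).

module Submission where

open import Defs
open import Data.Bool using (Bool; true; false; _∧_; _∨_; not)
import Data.Bool.Properties as BP
open import Data.Bool.ListAction using (or; any; all)
open import Data.Nat using (ℕ; zero; suc; _+_; _*_; _∸_; _^_; _≤_; _<_; _≟_; z≤n; s≤s; >-nonZero)
import Data.Nat.Properties as NP
open import Data.List using (List; []; _∷_; _++_; length; filter; map; concatMap; foldr)
import Data.List.Properties as LP
import Data.List.Relation.Unary.All as All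
import Data.List.Relation.Unary.All.Properties as AllP
open import Data.Nat.ListAction using (sum)
open import Data.Nat.ListAction.Properties using (sum-++)
open import Algebra.Bundles using (CommutativeMonoid)
import Algebra.Properties.CommutativeSemigroup as CommSemigroupProperties
open import Function using (_∘_; mk⇔)
open import Level using (0ℓ)
open import Data.Vec as Vec using (Vec; []; _∷_)
import Data.Vec.Properties as VP
open import Data.Product using (∃; _×_; _,_; proj₁; proj₂; uncurry)
open import Data.Product.Properties using (,-injective)
open import Data.Sum using (_⊎_; inj₁; inj₂)
open import Data.Empty using (⊥; ⊥-elim)
open import Relation.Nullary using (¬_; yes; does)
open import Relation.Nullary.Decidable using (isYes≗does; dec-true; dec-false; map′; _×-dec_)
open import Relation.Binary.Definitions using (DecidableEquality)
open import Relation.Binary.PropositionalEquality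
  using (_≡_; refl; sym; trans; cong; cong₂; subst; subst₂; module ≡-Reasoning)
open CommSemigroupProperties NP.+-commutativeSemigroup using () renaming (interchange to +-interchange)
open CommSemigroupProperties (CommutativeMonoid.commutativeSemigroup BP.∨-commutativeMonoid)
  using () renaming (interchange to ∨-interchange)
import Data.Integer as ℤ
import Data.Integer.Properties as ZP
open import Data.Rational as Q using (ℚ; mkℚ; _/_; 1ℚ)
import Data.Rational.Properties as QP
import Data.Nat.Coprimality as C
open import Data.Nat.Solver using (module +-*-Solver)
open +-*-Solver using (solve; _:+_; _:*_; _:=_; con)
open import Data.Rational.Solver using () renaming (module +-*-Solver to QS)

private
  variable
    A B : Set
    n m : ℕ

-- Indicators and finite sums

𝟙 : Bool → ℕ
𝟙 true  = 1
𝟙 false = 0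

𝟙-∧ : ∀ a b → 𝟙 (a ∧ b) ≡ 𝟙 a * 𝟙 b
𝟙-∧ true  b = sym (NP.+-identityʳ (𝟙 b))
𝟙-∧ false b = refl

∧≡true⁻ : ∀ {a b} → a ∧ b ≡ true → a ≡ true × b ≡ true
∧≡true⁻ {true} b≡true = refl , b≡true

∨≡true⁻ : ∀ {a b} → a ∨ b ≡ true → a ≡ true ⊎ b ≡ true
∨≡true⁻ {true}  _       = inj₁ refl
∨≡true⁻ {false} b≡true = inj₂ b≡true

𝟙-∨-≤ : ∀ a b → 𝟙 (a ∨ b) ≤ 𝟙 a + 𝟙 b
𝟙-∨-≤ true  b = s≤s z≤n
𝟙-∨-≤ false b = NP.≤-refl

𝟙-∨-disjoint : ∀ a b → (a ≡ true → b ≡ true → ⊥) → 𝟙 (a ∨ b) ≡ 𝟙 a + 𝟙 b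
𝟙-∨-disjoint true  true  disj = ⊥-elim (disj refl refl)
𝟙-∨-disjoint true  false disj = refl
𝟙-∨-disjoint false b     disj = refl

𝟙-implied : ∀ {a b} → (b ≡ true → a ≡ true) → 𝟙 a * 𝟙 b ≡ 𝟙 b
𝟙-implied {a} {true}  b⇒a rewrite b⇒a refl = refl
𝟙-implied {a} {false} b⇒a = NP.*-zeroʳ (𝟙 a)

not∨⁻ : ∀ {a b} → not a ∨ b ≡ true → a ≡ true → b ≡ true
not∨⁻ {true} b≡true _ = b≡true

not∨⁺ : ∀ {a b} → (a ≡ true → b ≡ true) → not a ∨ b ≡ true
not∨⁺ {true}  a⇒b = a⇒b refl
not∨⁺ {false} a⇒b = refl

∑ : List A → (A → ℕ) → ℕ
∑ xs f = sum (map f xs)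

syntax ∑ xs (λ x → e) = ∑[ x ← xs ] e

∑-cong : ∀ (xs : List A) {f g : A → ℕ} → (∀ x → f x ≡ g x) → ∑ xs f ≡ ∑ xs g
∑-cong xs f≗g = cong sum (LP.map-cong f≗g xs)

∑-mono-≤ : ∀ (xs : List A) {f g : A → ℕ} → (∀ x → f x ≤ g x) → ∑ xs f ≤ ∑ xs g
∑-mono-≤ []       f≤g = z≤n
∑-mono-≤ (x ∷ xs) f≤g = NP.+-mono-≤ (f≤g x) (∑-mono-≤ xs f≤g)

∑-zero : ∀ (xs : List A) → ∑[ x ← xs ] 0 ≡ 0
∑-zero []       = refl
∑-zero (x ∷ xs) = ∑-zero xs

∑-𝟙-false : ∀ (xs : List A) {p : A → Bool} → (∀ x → p x ≡ false) → ∑[ x ← xs ] 𝟙 (p x) ≡ 0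
∑-𝟙-false xs p≡false = trans (∑-cong xs (cong 𝟙 ∘ p≡false)) (∑-zero xs)

∑-++ : ∀ (xs ys : List A) f → ∑ (xs ++ ys) f ≡ ∑ xs f + ∑ ys f
∑-++ xs ys f = trans (cong sum (LP.map-++ f xs ys)) (sum-++ (map f xs) (map f ys))

∑-distrib-+ : ∀ (xs : List A) f g → ∑[ x ← xs ] (f x + g x) ≡ ∑ xs f + ∑ xs g
∑-distrib-+ []       f g = refl
∑-distrib-+ (x ∷ xs) f g = begin
  f x + g x + ∑[ y ← xs ] (f y + g y) ≡⟨ cong (f x + g x +_) (∑-distrib-+ xs f g) ⟩
  f x + g x + (∑ xs f + ∑ xs g)       ≡⟨ +-interchange (f x) (g x) (∑ xs f) (∑ xs g) ⟩
  f x + ∑ xs f + (g x + ∑ xs g)       ∎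
  where open ≡-Reasoning

∑-*ˡ : ∀ (xs : List A) c f → ∑[ x ← xs ] (c * f x) ≡ c * ∑ xs f
∑-*ˡ []       c f = sym (NP.*-zeroʳ c)
∑-*ˡ (x ∷ xs) c f = trans (cong (c * f x +_) (∑-*ˡ xs c f)) (sym (NP.*-distribˡ-+ c (f x) _))

∑-*ʳ : ∀ (xs : List A) c f → ∑[ x ← xs ] (f x * c) ≡ ∑ xs f * c
∑-*ʳ xs c f = trans (∑-cong xs (λ x → NP.*-comm (f x) c)) (trans (∑-*ˡ xs c f) (NP.*-comm c _))

∑-map : ∀ (g : A → B) (xs : List A) f → ∑ (map g xs) f ≡ ∑[ x ← xs ] f (g x)
∑-map g xs f = cong sum (sym (LP.map-∘ xs))

∑-concatMap : ∀ (g : A → List B) (xs : List A) f → ∑ (concatMap g xs) f ≡ ∑[ x ← xs ] ∑ (g x) f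
∑-concatMap g []       f = refl
∑-concatMap g (x ∷ xs) f = trans (∑-++ (g x) (concatMap g xs) f) (cong (∑ (g x) f +_) (∑-concatMap g xs f))

∑-filter : ∀ (p : A → Bool) (xs : List A) f →
           ∑ (filter (λ x → p x BP.≟ true) xs) f ≡ ∑[ x ← xs ] (𝟙 (p x) * f x)
∑-filter p []       f = refl
∑-filter p (x ∷ xs) f with p x
... | true  = cong₂ _+_ (sym (NP.+-identityʳ (f x))) (∑-filter p xs f)
... | false = ∑-filter p xs f

length≡∑1 : ∀ (xs : List A) → length xs ≡ ∑[ x ← xs ] 1
length≡∑1 []       = refl
length≡∑1 (x ∷ xs) = cong suc (length≡∑1 xs)

∑-comm : ∀ (xs : List A) (ys : List B) (f : A → B → ℕ) →
         ∑[ x ← xs ] ∑[ y ← ys ] f x y ≡ ∑[ y ← ys ] ∑[ x ← xs ] f x y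
∑-comm []       ys f = sym (∑-zero ys)
∑-comm (x ∷ xs) ys f =
  trans (cong (∑ ys (f x) +_) (∑-comm xs ys f)) (sym (∑-distrib-+ ys (f x) (λ y → ∑[ x′ ← xs ] f x′ y)))

-- The space F₂ⁿ and the enumeration of its points and matrices

⊕-assoc : ∀ (x y z : Pt n) → (x ⊕ y) ⊕ z ≡ x ⊕ (y ⊕ z)
⊕-assoc = VP.zipWith-assoc BP.xor-assoc

⊕-comm : ∀ (x y : Pt n) → x ⊕ y ≡ y ⊕ x
⊕-comm = VP.zipWith-comm BP.xor-comm

⊕-identityˡ : ∀ (x : Pt n) → zeroPt n ⊕ x ≡ x
⊕-identityˡ = VP.zipWith-identityˡ BP.xor-identityˡ

⊕-identityʳ : ∀ (x : Pt n) → x ⊕ zeroPt n ≡ x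
⊕-identityʳ = VP.zipWith-identityʳ BP.xor-identityʳ

⊕-self : ∀ (x : Pt n) → x ⊕ x ≡ zeroPt n
⊕-self []      = refl
⊕-self (a ∷ x) = cong₂ _∷_ (BP.xor-same a) (⊕-self x)

⊕-cancelˡ : ∀ (x y : Pt n) → x ⊕ (x ⊕ y) ≡ y
⊕-cancelˡ x y = begin
  x ⊕ (x ⊕ y)  ≡⟨ ⊕-assoc x x y ⟨
  (x ⊕ x) ⊕ y  ≡⟨ cong (_⊕ y) (⊕-self x) ⟩
  zeroPt _ ⊕ y ≡⟨ ⊕-identityˡ y ⟩
  y            ∎
  where open ≡-Reasoning

⊕-swapˡ : ∀ (x y z : Pt n) → x ⊕ (y ⊕ z) ≡ y ⊕ (x ⊕ z)
⊕-swapˡ x y z = trans (sym (⊕-assoc x y z)) (trans (cong (_⊕ z) (⊕-comm x y)) (⊕-assoc y x z))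

[v⊕x]⊕[v⊕y]≡x⊕y : ∀ (v x y : Pt n) → (v ⊕ x) ⊕ (v ⊕ y) ≡ x ⊕ y
[v⊕x]⊕[v⊕y]≡x⊕y v x y = begin
  (v ⊕ x) ⊕ (v ⊕ y) ≡⟨ ⊕-assoc v x (v ⊕ y) ⟩
  v ⊕ (x ⊕ (v ⊕ y)) ≡⟨ cong (v ⊕_) (⊕-swapˡ x v y) ⟩
  v ⊕ (v ⊕ (x ⊕ y)) ≡⟨ ⊕-cancelˡ v (x ⊕ y) ⟩
  x ⊕ y             ∎
  where open ≡-Reasoning

==⇒≡ : ∀ {x y : Pt n} → (x == y) ≡ true → x ≡ y
==⇒≡ {x = x} {y} eq with VP.≡-dec BP._≟_ x y
... | yes x≡y = x≡y

≡⇒== : ∀ {x y : Pt n} → x ≡ y → (x == y) ≡ true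
≡⇒== {x = x} {y} x≡y = trans (isYes≗does (VP.≡-dec BP._≟_ x y)) (dec-true (VP.≡-dec BP._≟_ x y) x≡y)

==-∷ : ∀ a b (x y : Pt n) → ((a ∷ x) == (b ∷ y)) ≡ does (a BP.≟ b) ∧ (x == y)
==-∷ a b x y = trans (isYes≗does (VP.≡-dec BP._≟_ (a ∷ x) (b ∷ y)))
                     (cong (does (a BP.≟ b) ∧_) (sym (isYes≗does (VP.≡-dec BP._≟_ x y))))

==-⊕ : ∀ (y x : Pt n) → (y == x) ≡ ((x ⊕ y) == zeroPt n)
==-⊕ y x = BP.⇔→≡ {z = true} (mk⇔ (≡⇒== ∘ to ∘ ==⇒≡) (≡⇒== ∘ from ∘ ==⇒≡))
  where
  to : y ≡ x → x ⊕ y ≡ zeroPt _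
  to refl = ⊕-self y
  from : x ⊕ y ≡ zeroPt _ → y ≡ x
  from x⊕y≡0 = trans (sym (⊕-cancelˡ x y)) (trans (cong (x ⊕_) x⊕y≡0) (⊕-identityʳ x))

fold-allPts-suc : (M : CommutativeMonoid 0ℓ 0ℓ) → let open CommutativeMonoid M in
  ∀ n (p : Pt (suc n) → Carrier) →
  foldr _∙_ ε (map p (allPts (suc n)))
    ≈ foldr _∙_ ε (map (p ∘ (false ∷_)) (allPts n)) ∙ foldr _∙_ ε (map (p ∘ (true ∷_)) (allPts n))
fold-allPts-suc M n p = go (allPts n)
  where
  open CommutativeMonoid M using (Carrier; _≈_; _∙_; ε; identityˡ; assoc; ∙-congˡ; setoid; commutativeSemigroup)
  open CommSemigroupProperties commutativeSemigroup using (interchange)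
  open import Relation.Binary.Reasoning.Setoid setoid
  fold : List (Pt n) → (Pt n → Carrier) → Carrier
  fold xs q = foldr _∙_ ε (map q xs)
  go : ∀ xs → foldr _∙_ ε (map p (concatMap (λ v → (false ∷ v) ∷ (true ∷ v) ∷ []) xs))
              ≈ fold xs (p ∘ (false ∷_)) ∙ fold xs (p ∘ (true ∷_))
  go []       = begin ε ≈⟨ identityˡ ε ⟨ ε ∙ ε ∎
  go (x ∷ xs) = begin
    p (false ∷ x) ∙ (p (true ∷ x) ∙ _)                       ≈⟨ ∙-congˡ (∙-congˡ (go xs)) ⟩
    p (false ∷ x) ∙ (p (true ∷ x) ∙ (fold xs _ ∙ fold xs _)) ≈⟨ assoc _ _ _ ⟨
    (p (false ∷ x) ∙ p (true ∷ x)) ∙ (fold xs _ ∙ fold xs _) ≈⟨ interchange _ _ _ _ ⟩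
    (p (false ∷ x) ∙ fold xs _) ∙ (p (true ∷ x) ∙ fold xs _) ∎

any-cong : ∀ (xs : List A) {p q : A → Bool} → (∀ x → p x ≡ q x) → any p xs ≡ any q xs
any-cong xs p≗q = cong or (LP.map-cong p≗q xs)

any-∨ : ∀ (xs : List A) p q → any (λ x → p x ∨ q x) xs ≡ any p xs ∨ any q xs
any-∨ []       p q = refl
any-∨ (x ∷ xs) p q = trans (cong ((p x ∨ q x) ∨_) (any-∨ xs p q)) (∨-interchange (p x) (q x) _ _)

∑-allPts-suc : ∀ n (f : Pt (suc n) → ℕ) →
  ∑ (allPts (suc n)) f ≡ ∑[ v ← allPts n ] f (false ∷ v) + ∑[ v ← allPts n ] f (true ∷ v)
∑-allPts-suc = fold-allPts-suc NP.+-0-commutativeMonoid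

any-allPts-suc : ∀ n (p : Pt (suc n) → Bool) →
  any p (allPts (suc n)) ≡ any (p ∘ (false ∷_)) (allPts n) ∨ any (p ∘ (true ∷_)) (allPts n)
any-allPts-suc = fold-allPts-suc BP.∨-commutativeMonoid

all-allPts-suc : ∀ n (p : Pt (suc n) → Bool) →
  all p (allPts (suc n)) ≡ all (p ∘ (false ∷_)) (allPts n) ∧ all (p ∘ (true ∷_)) (allPts n)
all-allPts-suc = fold-allPts-suc BP.∧-commutativeMonoid

∑-allMats-suc : ∀ n m (f : Mat n (suc m) → ℕ) →
  ∑ (allMats n (suc m)) f ≡ ∑[ M ← allMats n m ] ∑[ v ← allPts n ] f (v ∷ M)
∑-allMats-suc n m f = trans (∑-concatMap _ (allMats n m) f) (∑-cong (allMats n m) (λ M → ∑-map (_∷ M) (allPts n) f))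

∑-allPts-1 : ∀ n → ∑[ x ← allPts n ] 1 ≡ 2 ^ n
∑-allPts-1 zero    = refl
∑-allPts-1 (suc n) = trans (∑-allPts-suc n (λ _ → 1))
  (trans (cong (λ s → s + s) (∑-allPts-1 n)) (cong (2 ^ n +_) (sym (NP.+-identityʳ _))))

∑-allMats-1 : ∀ n m → ∑[ M ← allMats n m ] 1 ≡ (2 ^ n) ^ m
∑-allMats-1 n zero    = refl
∑-allMats-1 n (suc m) = begin
  ∑ (allMats n (suc m)) (λ _ → 1)           ≡⟨ ∑-allMats-suc n m (λ _ → 1) ⟩
  ∑[ M ← allMats n m ] ∑[ v ← allPts n ] 1  ≡⟨ ∑-cong (allMats n m) (λ _ → ∑-allPts-1 n) ⟩
  ∑[ M ← allMats n m ] (2 ^ n)              ≡⟨ ∑-cong (allMats n m) (λ _ → NP.*-identityˡ (2 ^ n)) ⟨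
  ∑[ M ← allMats n m ] (1 * 2 ^ n)          ≡⟨ ∑-*ʳ (allMats n m) (2 ^ n) (λ _ → 1) ⟩
  ∑[ M ← allMats n m ] 1 * 2 ^ n            ≡⟨ cong (_* 2 ^ n) (∑-allMats-1 n m) ⟩
  (2 ^ n) ^ m * 2 ^ n                       ≡⟨ NP.*-comm _ (2 ^ n) ⟩
  (2 ^ n) ^ suc m                           ∎
  where open ≡-Reasoning

length-allMats : ∀ n m → length (allMats n m) ≡ (2 ^ n) ^ m
length-allMats n m = trans (length≡∑1 (allMats n m)) (∑-allMats-1 n m)

0<length-allMats : ∀ n m → 0 < length (allMats n m)
0<length-allMats n m = subst (0 <_) (sym (length-allMats n m)) (NP.m^n>0 (2 ^ n) {{>-nonZero (NP.m^n>0 2 n)}} m)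

∑-allPts-translate : ∀ n (v : Pt n) (f : Pt n → ℕ) → ∑[ x ← allPts n ] f (v ⊕ x) ≡ ∑ (allPts n) f
∑-allPts-translate zero    []          f = refl
∑-allPts-translate (suc n) (false ∷ v) f = begin
  ∑[ x ← allPts (suc n) ] f ((false ∷ v) ⊕ x)
    ≡⟨ ∑-allPts-suc n (λ x → f ((false ∷ v) ⊕ x)) ⟩
  ∑[ x ← allPts n ] f (false ∷ v ⊕ x) + ∑[ x ← allPts n ] f (true ∷ v ⊕ x)
    ≡⟨ cong₂ _+_ (∑-allPts-translate n v (f ∘ (false ∷_))) (∑-allPts-translate n v (f ∘ (true ∷_))) ⟩
  ∑[ x ← allPts n ] f (false ∷ x) + ∑[ x ← allPts n ] f (true ∷ x)
    ≡⟨ ∑-allPts-suc n f ⟨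
  ∑ (allPts (suc n)) f ∎
  where open ≡-Reasoning
∑-allPts-translate (suc n) (true ∷ v) f = begin
  ∑[ x ← allPts (suc n) ] f ((true ∷ v) ⊕ x)
    ≡⟨ ∑-allPts-suc n (λ x → f ((true ∷ v) ⊕ x)) ⟩
  ∑[ x ← allPts n ] f (true ∷ v ⊕ x) + ∑[ x ← allPts n ] f (false ∷ v ⊕ x)
    ≡⟨ cong₂ _+_ (∑-allPts-translate n v (f ∘ (true ∷_))) (∑-allPts-translate n v (f ∘ (false ∷_))) ⟩
  ∑[ x ← allPts n ] f (true ∷ x) + ∑[ x ← allPts n ] f (false ∷ x)
    ≡⟨ NP.+-comm (∑[ x ← allPts n ] f (true ∷ x)) _ ⟩
  ∑[ x ← allPts n ] f (false ∷ x) + ∑[ x ← allPts n ] f (true ∷ x)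
    ≡⟨ ∑-allPts-suc n f ⟨
  ∑ (allPts (suc n)) f ∎
  where open ≡-Reasoning

∑-allPts≡0 : ∀ n (f : Pt n → ℕ) → ∑ (allPts n) f ≡ 0 → ∀ x → f x ≡ 0
∑-allPts≡0 zero    f ∑≡0 []          = NP.m+n≡0⇒m≡0 (f []) ∑≡0
∑-allPts≡0 (suc n) f ∑≡0 (false ∷ x) =
  ∑-allPts≡0 n _ (NP.m+n≡0⇒m≡0 _ (trans (sym (∑-allPts-suc n f)) ∑≡0)) x
∑-allPts≡0 (suc n) f ∑≡0 (true ∷ x)  =
  ∑-allPts≡0 n _ (NP.m+n≡0⇒n≡0 _ (trans (sym (∑-allPts-suc n f)) ∑≡0)) x

all-allPts-true⁻ : ∀ n (p : Pt n → Bool) → all p (allPts n) ≡ true → ∀ x → p x ≡ true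
all-allPts-true⁻ zero    p all≡true []          = trans (sym (BP.∧-identityʳ (p []))) all≡true
all-allPts-true⁻ (suc n) p all≡true (false ∷ x) =
  all-allPts-true⁻ n _ (proj₁ (∧≡true⁻ (trans (sym (all-allPts-suc n p)) all≡true))) x
all-allPts-true⁻ (suc n) p all≡true (true ∷ x)  =
  all-allPts-true⁻ n _ (proj₂ (∧≡true⁻ (trans (sym (all-allPts-suc n p)) all≡true))) x

all-true⁺ : ∀ (xs : List A) (p : A → Bool) → (∀ x → p x ≡ true) → all p xs ≡ true
all-true⁺ []       p p≡true = refl
all-true⁺ (x ∷ xs) p p≡true = cong₂ _∧_ (p≡true x) (all-true⁺ xs p p≡true)

-- Subsets and subspaces

infix 4 _∈_ _⊆_

_∈_ : Pt n → PSet n → Set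
x ∈ S = mem S x ≡ true

_⊆_ : PSet n → PSet n → Set
S ⊆ T = ∀ x → x ∈ S → x ∈ T

∣_∣ : PSet n → ℕ
∣_∣ {n} S = ∑[ x ← allPts n ] 𝟙 (mem S x)

mem-tab : ∀ (f : Pt n → Bool) x → mem (tab f) x ≡ f x
mem-tab {zero}  f []          = refl
mem-tab {suc n} f (false ∷ x) = mem-tab (f ∘ (false ∷_)) x
mem-tab {suc n} f (true ∷ x)  = mem-tab (f ∘ (true ∷_)) x

set-ext : ∀ {S T : PSet n} → (∀ x → mem S x ≡ mem T x) → S ≡ T
set-ext {zero}  S≗T = S≗T []
set-ext {suc n} S≗T = cong₂ _,_ (set-ext (S≗T ∘ (false ∷_))) (set-ext (S≗T ∘ (true ∷_)))

-- Built from ×-dec so that `does` reduces to the conjunction of the two halves.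
_≟ₛ_ : DecidableEquality (PSet n)
_≟ₛ_ {zero}  = BP._≟_
_≟ₛ_ {suc n} (s , t) (s′ , t′) = map′ (uncurry (cong₂ _,_)) ,-injective ((s ≟ₛ s′) ×-dec (t ≟ₛ t′))

does-≟ₛ⇒≡ : ∀ {S T : PSet n} → does (S ≟ₛ T) ≡ true → S ≡ T
does-≟ₛ⇒≡ {S = S} {T} eq with S ≟ₛ T
... | yes S≡T = S≡T

δ : PSet n → PSet n → ℕ
δ S T = 𝟙 (does (S ≟ₛ T))

∑-allPSets-δ : ∀ n (S : PSet n) (g : PSet n → ℕ) → ∑[ T ← allPSets n ] (δ S T * g T) ≡ g S
∑-allPSets-δ zero    false g = trans (NP.+-identityʳ _) (NP.+-identityʳ (g false))
∑-allPSets-δ zero    true  g = trans (NP.+-identityʳ _) (NP.+-identityʳ (g true))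
∑-allPSets-δ (suc n) (s , t) g = begin
  ∑[ T ← allPSets (suc n) ] (δ (s , t) T * g T)
    ≡⟨ ∑-concatMap _ (allPSets n) _ ⟩
  ∑[ s′ ← allPSets n ] ∑ (map (s′ ,_) (allPSets n)) (λ T → δ (s , t) T * g T)
    ≡⟨ ∑-cong (allPSets n) (λ s′ → ∑-map (s′ ,_) (allPSets n) _) ⟩
  ∑[ s′ ← allPSets n ] ∑[ t′ ← allPSets n ] (𝟙 (does (s ≟ₛ s′) ∧ does (t ≟ₛ t′)) * g (s′ , t′))
    ≡⟨ ∑-cong (allPSets n) (λ s′ → ∑-cong (allPSets n) (λ t′ → split s′ t′)) ⟩
  ∑[ s′ ← allPSets n ] ∑[ t′ ← allPSets n ] (δ s s′ * (δ t t′ * g (s′ , t′)))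
    ≡⟨ ∑-cong (allPSets n) (λ s′ → ∑-*ˡ (allPSets n) (δ s s′) _) ⟩
  ∑[ s′ ← allPSets n ] (δ s s′ * ∑[ t′ ← allPSets n ] (δ t t′ * g (s′ , t′)))
    ≡⟨ ∑-cong (allPSets n) (λ s′ → cong (δ s s′ *_) (∑-allPSets-δ n t (λ t′ → g (s′ , t′)))) ⟩
  ∑[ s′ ← allPSets n ] (δ s s′ * g (s′ , t))
    ≡⟨ ∑-allPSets-δ n s (λ s′ → g (s′ , t)) ⟩
  g (s , t) ∎
  where
  open ≡-Reasoning
  split : ∀ s′ t′ → 𝟙 (does (s ≟ₛ s′) ∧ does (t ≟ₛ t′)) * g (s′ , t′) ≡ δ s s′ * (δ t t′ * g (s′ , t′))
  split s′ t′ = trans (cong (_* g (s′ , t′)) (𝟙-∧ (does (s ≟ₛ s′)) _)) (NP.*-assoc (δ s s′) _ _)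

∑-fibres : ∀ (xs : List A) (key : A → PSet n) (ψ : PSet n → ℕ) →
  ∑[ T ← allPSets n ] (ψ T * ∑[ x ← xs ] δ (key x) T) ≡ ∑[ x ← xs ] ψ (key x)
∑-fibres {n = n} xs key ψ = begin
  ∑[ T ← allPSets n ] (ψ T * ∑[ x ← xs ] δ (key x) T)
    ≡⟨ ∑-cong (allPSets n) (λ T → ∑-*ˡ xs (ψ T) (λ x → δ (key x) T)) ⟨
  ∑[ T ← allPSets n ] ∑[ x ← xs ] (ψ T * δ (key x) T)
    ≡⟨ ∑-comm (allPSets n) xs _ ⟩
  ∑[ x ← xs ] ∑[ T ← allPSets n ] (ψ T * δ (key x) T)
    ≡⟨ ∑-cong xs (λ x → trans (∑-cong (allPSets n) (λ T → NP.*-comm (ψ T) _)) (∑-allPSets-δ n (key x) ψ)) ⟩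
  ∑[ x ← xs ] ψ (key x) ∎
  where open ≡-Reasoning

⊆-antisym : ∀ {S T : PSet n} → S ⊆ T → T ⊆ S → S ≡ T
⊆-antisym S⊆T T⊆S = set-ext (λ x → BP.⇔→≡ {z = true} (mk⇔ (S⊆T x) (T⊆S x)))

record IsSubspace (S : PSet n) : Set where
  field
    zero∈    : zeroPt n ∈ S
    ⊕-closed : ∀ {x y} → x ∈ S → y ∈ S → x ⊕ y ∈ S

open IsSubspace

-- For a subspace S, adjoin S v = S ∪ (v + S) is the span of S and v.
adjoin : PSet n → Pt n → PSet n
adjoin S v = tab (λ x → mem S x ∨ mem S (v ⊕ x))

adjoinAll : PSet n → Mat n m → PSet n
adjoinAll S []      = S
adjoinAll S (v ∷ V) = adjoinAll (adjoin S v) V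

module _ {S : PSet n} {v : Pt n} where

  mem-adjoin : ∀ x → mem (adjoin S v) x ≡ mem S x ∨ mem S (v ⊕ x)
  mem-adjoin = mem-tab _

  ⊆-adjoin : S ⊆ adjoin S v
  ⊆-adjoin x x∈S = trans (mem-adjoin x) (cong (_∨ mem S (v ⊕ x)) x∈S)

  ∈-adjoin⁺ : ∀ {x} → v ⊕ x ∈ S → x ∈ adjoin S v
  ∈-adjoin⁺ {x} v⊕x∈S = trans (mem-adjoin x) (trans (cong (mem S x ∨_) v⊕x∈S) (BP.∨-zeroʳ (mem S x)))

  ∈-adjoin⁻ : ∀ {x} → x ∈ adjoin S v → x ∈ S ⊎ v ⊕ x ∈ S
  ∈-adjoin⁻ {x} x∈ = ∨≡true⁻ (trans (sym (mem-adjoin x)) x∈)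

  v∈adjoin : zeroPt n ∈ S → v ∈ adjoin S v
  v∈adjoin 0∈S = ∈-adjoin⁺ (subst (_∈ S) (sym (⊕-self v)) 0∈S)

  adjoin-⊆ : ∀ {L} → IsSubspace L → S ⊆ L → v ∈ L → adjoin S v ⊆ L
  adjoin-⊆ L-sub S⊆L v∈L x x∈ with ∈-adjoin⁻ x∈
  ... | inj₁ x∈S   = S⊆L x x∈S
  ... | inj₂ v⊕x∈S = subst (_∈ _) (⊕-cancelˡ v x) (⊕-closed L-sub v∈L (S⊆L _ v⊕x∈S))

  adjoin-∈ : IsSubspace S → v ∈ S → adjoin S v ≡ S
  adjoin-∈ S-sub v∈S = ⊆-antisym (adjoin-⊆ S-sub (λ _ x∈S → x∈S) v∈S) ⊆-adjoin

  adjoin-isSubspace : IsSubspace S → IsSubspace (adjoin S v)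
  adjoin-isSubspace S-sub = record { zero∈ = ⊆-adjoin _ (zero∈ S-sub) ; ⊕-closed = closed }
    where
    closed : ∀ {x y} → x ∈ adjoin S v → y ∈ adjoin S v → x ⊕ y ∈ adjoin S v
    closed {x} {y} x∈ y∈ with ∈-adjoin⁻ x∈ | ∈-adjoin⁻ y∈
    ... | inj₁ x∈S   | inj₁ y∈S   = ⊆-adjoin _ (⊕-closed S-sub x∈S y∈S)
    ... | inj₁ x∈S   | inj₂ v⊕y∈S =
      ∈-adjoin⁺ (subst (_∈ S) (⊕-swapˡ x v y) (⊕-closed S-sub x∈S v⊕y∈S))
    ... | inj₂ v⊕x∈S | inj₁ y∈S   =
      ∈-adjoin⁺ (subst (_∈ S) (⊕-assoc v x y) (⊕-closed S-sub v⊕x∈S y∈S))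
    ... | inj₂ v⊕x∈S | inj₂ v⊕y∈S =
      ⊆-adjoin _ (subst (_∈ S) ([v⊕x]⊕[v⊕y]≡x⊕y v x y) (⊕-closed S-sub v⊕x∈S v⊕y∈S))

module _ (S : PSet n) (v : Pt n) where

  private
    ∣S∣+∣S∣ : ∑[ x ← allPts n ] (𝟙 (mem S x) + 𝟙 (mem S (v ⊕ x))) ≡ ∣ S ∣ + ∣ S ∣
    ∣S∣+∣S∣ = trans (∑-distrib-+ (allPts n) _ _) (cong (∣ S ∣ +_) (∑-allPts-translate n v (𝟙 ∘ mem S)))

  ∣adjoin∣-≤ : ∣ adjoin S v ∣ ≤ ∣ S ∣ + ∣ S ∣
  ∣adjoin∣-≤ = NP.≤-trans (∑-mono-≤ (allPts n) pointwise) (NP.≤-reflexive ∣S∣+∣S∣)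
    where
    pointwise : ∀ x → 𝟙 (mem (adjoin S v) x) ≤ 𝟙 (mem S x) + 𝟙 (mem S (v ⊕ x))
    pointwise x = subst (λ b → 𝟙 b ≤ 𝟙 (mem S x) + 𝟙 (mem S (v ⊕ x))) (sym (mem-adjoin x)) (𝟙-∨-≤ (mem S x) _)

  ∣adjoin∣-∉ : IsSubspace S → ¬ v ∈ S → ∣ adjoin S v ∣ ≡ ∣ S ∣ + ∣ S ∣
  ∣adjoin∣-∉ S-sub v∉S = trans (∑-cong (allPts n) pointwise) ∣S∣+∣S∣
    where
    -- x and v ⊕ x cannot both lie in S, since their sum v does not
    pointwise : ∀ x → 𝟙 (mem (adjoin S v) x) ≡ 𝟙 (mem S x) + 𝟙 (mem S (v ⊕ x))
    pointwise x = trans (cong 𝟙 (mem-adjoin x)) (𝟙-∨-disjoint (mem S x) _ (λ x∈S v⊕x∈S →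
      v∉S (subst (_∈ S) (trans (⊕-swapˡ x v x) (trans (cong (v ⊕_) (⊕-self x)) (⊕-identityʳ v)))
                         (⊕-closed S-sub x∈S v⊕x∈S))))

⊆-adjoinAll : ∀ (S : PSet n) (V : Mat n m) → S ⊆ adjoinAll S V
⊆-adjoinAll S []      x x∈S = x∈S
⊆-adjoinAll S (v ∷ V) x x∈S = ⊆-adjoinAll (adjoin S v) V x (⊆-adjoin x x∈S)

∣adjoinAll∣-≤ : ∀ (S : PSet n) (V : Mat n m) → ∣ adjoinAll S V ∣ ≤ ∣ S ∣ * 2 ^ m
∣adjoinAll∣-≤ S []      = NP.≤-reflexive (sym (NP.*-identityʳ ∣ S ∣))
∣adjoinAll∣-≤ {m = suc m} S (v ∷ V) = begin
  ∣ adjoinAll (adjoin S v) V ∣ ≤⟨ ∣adjoinAll∣-≤ (adjoin S v) V ⟩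
  ∣ adjoin S v ∣ * 2 ^ m       ≤⟨ NP.*-monoˡ-≤ (2 ^ m) (∣adjoin∣-≤ S v) ⟩
  (∣ S ∣ + ∣ S ∣) * 2 ^ m      ≡⟨ solve 2 (λ s p → (s :+ s) :* p := s :* (con 2 :* p)) refl ∣ S ∣ (2 ^ m) ⟩
  ∣ S ∣ * 2 ^ suc m            ∎
  where open NP.≤-Reasoning

adjoinAll-++ : ∀ {a b} (S : PSet n) (U : Mat n a) (V : Mat n b) →
  adjoinAll S (U Vec.++ V) ≡ adjoinAll (adjoinAll S U) V
adjoinAll-++ S []      V = refl
adjoinAll-++ S (u ∷ U) V = adjoinAll-++ (adjoin S u) U V

mem-adjoinAll : ∀ (S : PSet n) (V : Mat n m) x →
  mem (adjoinAll S V) x ≡ any (λ c → mem S (x ⊕ lincomb c V)) (allPts m)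
mem-adjoinAll S []              x = trans (cong (mem S) (sym (⊕-identityʳ x))) (sym (BP.∨-identityʳ _))
mem-adjoinAll {m = suc m} S (v ∷ V) x = begin
  mem (adjoinAll (adjoin S v) V) x
    ≡⟨ mem-adjoinAll (adjoin S v) V x ⟩
  any (λ c → mem (adjoin S v) (x ⊕ lincomb c V)) (allPts m)
    ≡⟨ any-cong (allPts m) (λ c → trans (mem-adjoin (x ⊕ lincomb c V)) (cong (λ y → _ ∨ mem S y) (⊕-swapˡ v x _))) ⟩
  any (λ c → mem S (x ⊕ lincomb c V) ∨ mem S (x ⊕ (v ⊕ lincomb c V))) (allPts m)
    ≡⟨ any-∨ (allPts m) _ _ ⟩
  any (λ c → mem S (x ⊕ lincomb c V)) (allPts m) ∨ any (λ c → mem S (x ⊕ (v ⊕ lincomb c V))) (allPts m)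
    ≡⟨ any-allPts-suc m (λ c → mem S (x ⊕ lincomb c (v ∷ V))) ⟨
  any (λ c → mem S (x ⊕ lincomb c (v ∷ V))) (allPts (suc m)) ∎
  where open ≡-Reasoning

𝟎 : ∀ n → PSet n
𝟎 n = tab (_== zeroPt n)

∈𝟎⁻ : ∀ {x : Pt n} → x ∈ 𝟎 n → x ≡ zeroPt n
∈𝟎⁻ {x = x} x∈𝟎 = ==⇒≡ (trans (sym (mem-tab _ x)) x∈𝟎)

𝟎-isSubspace : ∀ n → IsSubspace (𝟎 n)
𝟎-isSubspace n = record { zero∈ = ∈𝟎⁺ ; ⊕-closed = closed }
  where
  ∈𝟎⁺ : zeroPt n ∈ 𝟎 n
  ∈𝟎⁺ = trans (mem-tab _ (zeroPt n)) (≡⇒== refl)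
  closed : ∀ {x y} → x ∈ 𝟎 n → y ∈ 𝟎 n → x ⊕ y ∈ 𝟎 n
  closed x∈𝟎 y∈𝟎 = subst (_∈ 𝟎 n) (sym (trans (cong₂ _⊕_ (∈𝟎⁻ x∈𝟎) (∈𝟎⁻ y∈𝟎)) (⊕-self (zeroPt n)))) ∈𝟎⁺

∣𝟎∣ : ∀ n → ∣ 𝟎 n ∣ ≡ 1
∣𝟎∣ n = trans (∑-cong (allPts n) (λ x → cong 𝟙 (mem-tab _ x))) (count-zero n)
  where
  count-zero : ∀ n → ∑[ x ← allPts n ] 𝟙 (x == zeroPt n) ≡ 1
  count-zero zero    = refl
  count-zero (suc n) = begin
    ∑[ x ← allPts (suc n) ] 𝟙 (x == zeroPt (suc n))
      ≡⟨ ∑-allPts-suc n _ ⟩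
    ∑[ x ← allPts n ] 𝟙 ((false ∷ x) == zeroPt (suc n)) + ∑[ x ← allPts n ] 𝟙 ((true ∷ x) == zeroPt (suc n))
      ≡⟨ cong₂ _+_ (∑-cong (allPts n) (λ x → cong 𝟙 (==-∷ false false x (zeroPt n))))
                   (∑-cong (allPts n) (λ x → cong 𝟙 (==-∷ true false x (zeroPt n)))) ⟩
    ∑[ x ← allPts n ] 𝟙 (x == zeroPt n) + ∑[ x ← allPts n ] 0
      ≡⟨ cong₂ _+_ (count-zero n) (∑-zero (allPts n)) ⟩
    1 ∎
    where open ≡-Reasoning

im≡adjoinAll𝟎 : ∀ (M : Mat n m) → im M ≡ adjoinAll (𝟎 n) M
im≡adjoinAll𝟎 {n} {m} M = set-ext λ x → begin
  mem (im M) x                                   ≡⟨ mem-tab _ x ⟩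
  any (λ c → lincomb c M == x) (allPts m)        ≡⟨ any-cong (allPts m) (λ c → ==-⊕ (lincomb c M) x) ⟩
  any (λ c → (x ⊕ lincomb c M) == zeroPt n) (allPts m)
    ≡⟨ any-cong (allPts m) (λ c → mem-tab _ (x ⊕ lincomb c M)) ⟨
  any (λ c → mem (𝟎 n) (x ⊕ lincomb c M)) (allPts m) ≡⟨ mem-adjoinAll (𝟎 n) M x ⟨
  mem (adjoinAll (𝟎 n) M) x                      ∎
  where open ≡-Reasoning

im-++ : ∀ {a b} (M : Mat n a) (V : Mat n b) → im (M Vec.++ V) ≡ adjoinAll (im M) V
im-++ {n} M V = begin
  im (M Vec.++ V)                      ≡⟨ im≡adjoinAll𝟎 (M Vec.++ V) ⟩
  adjoinAll (𝟎 n) (M Vec.++ V)         ≡⟨ adjoinAll-++ (𝟎 n) M V ⟩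
  adjoinAll (adjoinAll (𝟎 n) M) V      ≡⟨ cong (λ S → adjoinAll S V) (im≡adjoinAll𝟎 M) ⟨
  adjoinAll (im M) V                   ∎
  where open ≡-Reasoning

𝟎⊆ : ∀ {S : PSet n} → IsSubspace S → 𝟎 n ⊆ S
𝟎⊆ {S = S} S-sub x x∈𝟎 = subst (_∈ S) (sym (∈𝟎⁻ x∈𝟎)) (zero∈ S-sub)

𝟏 : ∀ n → PSet n
𝟏 n = tab (λ _ → true)

⊆𝟏 : ∀ (S : PSet n) → S ⊆ 𝟏 n
⊆𝟏 S x _ = mem-tab _ x

𝟏-isSubspace : ∀ n → IsSubspace (𝟏 n)
𝟏-isSubspace n = record { zero∈ = mem-tab _ (zeroPt n) ; ⊕-closed = λ {x} {y} _ _ → mem-tab _ (x ⊕ y) }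

∣𝟏∣ : ∀ n → ∣ 𝟏 n ∣ ≡ 2 ^ n
∣𝟏∣ n = trans (∑-cong (allPts n) (λ x → cong 𝟙 (mem-tab _ x))) (∑-allPts-1 n)

module _ {S T : PSet n} (S⊆T : S ⊆ T) where

  ∣∣-⊆-split : ∣ T ∣ ≡ ∣ S ∣ + ∑[ x ← allPts n ] 𝟙 (mem T x ∧ not (mem S x))
  ∣∣-⊆-split = trans (∑-cong (allPts n) pointwise) (∑-distrib-+ (allPts n) _ _)
    where
    pointwise : ∀ x → 𝟙 (mem T x) ≡ 𝟙 (mem S x) + 𝟙 (mem T x ∧ not (mem S x))
    pointwise x with mem S x in x∈S
    ... | true rewrite S⊆T x x∈S = refl
    ... | false = cong 𝟙 (sym (BP.∧-identityʳ (mem T x)))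

  ∑-∖ : ∑[ x ← allPts n ] 𝟙 (mem T x ∧ not (mem S x)) ≡ ∣ T ∣ ∸ ∣ S ∣
  ∑-∖ = sym (trans (cong (_∸ ∣ S ∣) ∣∣-⊆-split) (NP.m+n∸m≡n ∣ S ∣ _))

  ⊆-∣∣-≡ : ∣ S ∣ ≡ ∣ T ∣ → S ≡ T
  ⊆-∣∣-≡ ∣S∣≡∣T∣ = ⊆-antisym S⊆T T⊆S
    where
    ∑∖≡0 : ∑[ x ← allPts n ] 𝟙 (mem T x ∧ not (mem S x)) ≡ 0
    ∑∖≡0 = NP.+-cancelˡ-≡ ∣ S ∣ _ 0 (trans (sym ∣∣-⊆-split) (trans (sym ∣S∣≡∣T∣) (sym (NP.+-identityʳ _))))
    T⊆S : T ⊆ S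
    T⊆S x x∈T with mem S x in x∈S | ∑-allPts≡0 n _ ∑∖≡0 x
    ... | true  | _     = refl
    ... | false | 𝟙≡0 rewrite x∈T = ⊥-elim (NP.1+n≢0 𝟙≡0)

natEq⇒≡ : ∀ {a b} → natEq a b ≡ true → a ≡ b
natEq⇒≡ {a} {b} eq with a ≟ b
... | yes a≡b = a≡b

≡⇒natEq : ∀ {a b} → a ≡ b → natEq a b ≡ true
≡⇒natEq {a} {b} a≡b = trans (isYes≗does (a ≟ b)) (dec-true (a ≟ b) a≡b)

≢⇒natEq : ∀ {a b} → ¬ a ≡ b → natEq a b ≡ false
≢⇒natEq {a} {b} a≢b = trans (isYes≗does (a ≟ b)) (dec-false (a ≟ b) a≢b)

^ℕ≡^ : ∀ b e → b ^ℕ e ≡ b ^ e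
^ℕ≡^ b zero    = refl
^ℕ≡^ b (suc e) = cong (b *_) (^ℕ≡^ b e)

count≡∣∣ : ∀ (S : PSet n) → count S ≡ ∣ S ∣
count≡∣∣ {n} S = begin
  count S                                          ≡⟨ length≡∑1 (filter (λ x → mem S x BP.≟ true) (allPts n)) ⟩
  ∑[ x ← filter (λ x → mem S x BP.≟ true) (allPts n) ] 1 ≡⟨ ∑-filter (mem S) (allPts n) _ ⟩
  ∑[ x ← allPts n ] (𝟙 (mem S x) * 1)              ≡⟨ ∑-cong (allPts n) (λ x → NP.*-identityʳ _) ⟩
  ∣ S ∣                                            ∎
  where open ≡-Reasoning

subsetB⁻ : ∀ {S T : PSet n} → subsetB S T ≡ true → S ⊆ T
subsetB⁻ {n} subset x = not∨⁻ (all-allPts-true⁻ n _ subset x)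

subsetB⁺ : ∀ {S T : PSet n} → S ⊆ T → subsetB S T ≡ true
subsetB⁺ {n} S⊆T = all-true⁺ (allPts n) _ (λ x → not∨⁺ (S⊆T x))

module _ {n} (m : ℕ) (S : PSet n) where

  private
    closedB : Bool
    closedB = all (λ x → all (λ y → not (mem S x ∧ mem S y) ∨ mem S (x ⊕ y)) (allPts n)) (allPts n)

  isGrass⁻ : isGrass n m S ≡ true → IsSubspace S × ∣ S ∣ ≡ 2 ^ m
  isGrass⁻ grass =
    let 0∈S , rest = ∧≡true⁻ grass
        closed , size = ∧≡true⁻ rest
    in record { zero∈ = 0∈S
              ; ⊕-closed = λ {x} {y} x∈S y∈S →
                  not∨⁻ (all-allPts-true⁻ n _ (all-allPts-true⁻ n _ closed x) y) (cong₂ _∧_ x∈S y∈S) }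
     , trans (sym (count≡∣∣ S)) (trans (natEq⇒≡ size) (^ℕ≡^ 2 m))

  isGrass⁺ : IsSubspace S → ∣ S ∣ ≡ 2 ^ m → isGrass n m S ≡ true
  isGrass⁺ S-sub ∣S∣≡2^m = cong₂ _∧_ (zero∈ S-sub) (cong₂ _∧_ closed size)
    where
    closed : closedB ≡ true
    closed = all-true⁺ (allPts n) _ λ x → all-true⁺ (allPts n) _ λ y →
               not∨⁺ (λ x∧y → let x∈S , y∈S = ∧≡true⁻ x∧y in ⊕-closed S-sub x∈S y∈S)
    size : natEq (count S) (2 ^ℕ m) ≡ true
    size = ≡⇒natEq (trans (count≡∣∣ S) (trans ∣S∣≡2^m (sym (^ℕ≡^ 2 m))))

  isGrass-∣∣≢ : ¬ ∣ S ∣ ≡ 2 ^ m → isGrass n m S ≡ false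
  isGrass-∣∣≢ ∣S∣≢2^m = begin
    mem S (zeroPt n) ∧ closedB ∧ natEq (count S) (2 ^ℕ m) ≡⟨ cong (λ b → mem S (zeroPt n) ∧ closedB ∧ b) size ⟩
    mem S (zeroPt n) ∧ closedB ∧ false                   ≡⟨ cong (mem S (zeroPt n) ∧_) (BP.∧-zeroʳ closedB) ⟩
    mem S (zeroPt n) ∧ false                             ≡⟨ BP.∧-zeroʳ (mem S (zeroPt n)) ⟩
    false                                                ∎
    where
    open ≡-Reasoning
    size : natEq (count S) (2 ^ℕ m) ≡ false
    size = ≢⇒natEq (λ eq → ∣S∣≢2^m (trans (sym (count≡∣∣ S)) (trans eq (^ℕ≡^ 2 m))))

-- Counting extensions of a subspace

extensionCount : ℕ → ℕ → ℕ → ℕ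
extensionCount t a zero    = 1
extensionCount t a (suc d) = (2 ^ t ∸ 2 ^ a) * extensionCount t (suc a) d

isGrassIn : PSet n → ℕ → PSet n → Bool
isGrassIn {n} L m X = subsetB X L ∧ isGrass n m X

isGrassIn-adjoinAll-too-small : ∀ a {d} (L S : PSet n) (V : Mat n d) → ∣ S ∣ ≡ 2 ^ a →
  isGrassIn L (a + suc d) (adjoinAll S V) ≡ false
isGrassIn-adjoinAll-too-small a {d} L S V ∣S∣≡2^a = trans
  (cong (subsetB (adjoinAll S V) L ∧_) (isGrass-∣∣≢ (a + suc d) (adjoinAll S V) (NP.<⇒≢ ∣adjoinAll∣<2^[a+1+d])))
  (BP.∧-zeroʳ (subsetB (adjoinAll S V) L))
  where
  open NP.≤-Reasoning
  ∣adjoinAll∣<2^[a+1+d] : ∣ adjoinAll S V ∣ < 2 ^ (a + suc d)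
  ∣adjoinAll∣<2^[a+1+d] = begin-strict
    ∣ adjoinAll S V ∣ ≤⟨ ∣adjoinAll∣-≤ S V ⟩
    ∣ S ∣ * 2 ^ d     ≡⟨ cong (_* 2 ^ d) ∣S∣≡2^a ⟩
    2 ^ a * 2 ^ d     ≡⟨ NP.^-distribˡ-+-* 2 a d ⟨
    2 ^ (a + d)       <⟨ NP.^-monoʳ-< 2 (s≤s (s≤s z≤n)) (NP.n<1+n (a + d)) ⟩
    2 ^ suc (a + d)   ≡⟨ cong (2 ^_) (NP.+-suc a d) ⟨
    2 ^ (a + suc d)   ∎

isGrassIn-adjoinAll-∉ : ∀ {d} e (L S : PSet n) v (V : Mat n d) → zeroPt n ∈ S → ¬ v ∈ L →
  isGrassIn L e (adjoinAll (adjoin S v) V) ≡ false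
isGrassIn-adjoinAll-∉ e L S v V 0∈S v∉L = cong (_∧ _) (BP.¬-not λ ⊆L →
  v∉L (subsetB⁻ ⊆L v (⊆-adjoinAll (adjoin S v) V v (v∈adjoin {S = S} 0∈S))))

∑-isGrassIn-adjoinAll : ∀ d {a t} {S L : PSet n} → IsSubspace S → IsSubspace L → S ⊆ L →
  ∣ S ∣ ≡ 2 ^ a → ∣ L ∣ ≡ 2 ^ t →
  ∑[ V ← allMats n d ] 𝟙 (isGrassIn L (a + d) (adjoinAll S V)) ≡ extensionCount t a d
∑-isGrassIn-adjoinAll zero {a} {S = S} S-sub L-sub S⊆L ∣S∣≡2^a ∣L∣≡2^t
  rewrite NP.+-identityʳ a | subsetB⁺ S⊆L | isGrass⁺ a S S-sub ∣S∣≡2^a = refl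
∑-isGrassIn-adjoinAll {n} (suc d) {a} {t} {S} {L} S-sub L-sub S⊆L ∣S∣≡2^a ∣L∣≡2^t = begin
  ∑ (allMats n (suc d)) f                              ≡⟨ ∑-allMats-suc n d f ⟩
  ∑[ V ← allMats n d ] ∑[ v ← allPts n ] f (v ∷ V)     ≡⟨ ∑-comm (allMats n d) (allPts n) _ ⟩
  ∑[ v ← allPts n ] ∑[ V ← allMats n d ] f (v ∷ V)     ≡⟨ ∑-cong (allPts n) by-first-vector ⟩
  ∑[ v ← allPts n ] (𝟙 (mem L v ∧ not (mem S v)) * c) ≡⟨ ∑-*ʳ (allPts n) c _ ⟩
  ∑[ v ← allPts n ] 𝟙 (mem L v ∧ not (mem S v)) * c   ≡⟨ cong (_* c) (∑-∖ S⊆L) ⟩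
  (∣ L ∣ ∸ ∣ S ∣) * c                                  ≡⟨ cong (_* c) (cong₂ _∸_ ∣L∣≡2^t ∣S∣≡2^a) ⟩
  extensionCount t a (suc d)                           ∎
  where
  open ≡-Reasoning
  f : Mat n (suc d) → ℕ
  f V = 𝟙 (isGrassIn L (a + suc d) (adjoinAll S V))
  c : ℕ
  c = extensionCount t (suc a) d
  by-first-vector : ∀ v → ∑[ V ← allMats n d ] f (v ∷ V) ≡ 𝟙 (mem L v ∧ not (mem S v)) * c
  by-first-vector v with mem S v in v∈S?
  ... | true  rewrite adjoin-∈ S-sub v∈S? | BP.∧-zeroʳ (mem L v) =
    ∑-𝟙-false (allMats n d) (λ V → isGrassIn-adjoinAll-too-small a L S V ∣S∣≡2^a)
  ... | false with mem L v in v∈L?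
  ...   | false = ∑-𝟙-false (allMats n d) λ V →
    isGrassIn-adjoinAll-∉ (a + suc d) L S v V (zero∈ S-sub) (BP.not-¬ v∈L?)
  ...   | true  = trans (subst (λ e → ∑[ V ← allMats n d ] 𝟙 (isGrassIn L e (adjoinAll (adjoin S v) V)) ≡ c)
                               (sym (NP.+-suc a d))
                               (∑-isGrassIn-adjoinAll d (adjoin-isSubspace S-sub) L-sub (adjoin-⊆ L-sub S⊆L v∈L?)
                                 ∣adjoin∣≡2^[1+a] ∣L∣≡2^t))
                        (sym (NP.+-identityʳ c))
    where
    ∣adjoin∣≡2^[1+a] : ∣ adjoin S v ∣ ≡ 2 ^ suc a
    ∣adjoin∣≡2^[1+a] = trans (∣adjoin∣-∉ S v S-sub (BP.not-¬ v∈S?))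
                             (trans (cong₂ _+_ ∣S∣≡2^a ∣S∣≡2^a) (cong (2 ^ a +_) (sym (NP.+-identityʳ _))))

∑-isGrass-adjoinAll : ∀ d {a} {S : PSet n} → IsSubspace S → ∣ S ∣ ≡ 2 ^ a →
  ∑[ V ← allMats n d ] 𝟙 (isGrass n (a + d) (adjoinAll S V)) ≡ extensionCount n a d
∑-isGrass-adjoinAll {n} d {a} {S} S-sub ∣S∣≡2^a = trans
  (∑-cong (allMats n d) λ V →
    cong (λ b → 𝟙 (b ∧ isGrass n (a + d) (adjoinAll S V))) (sym (subsetB⁺ (⊆𝟏 (adjoinAll S V)))))
  (∑-isGrassIn-adjoinAll d S-sub (𝟏-isSubspace n) (⊆𝟏 S) ∣S∣≡2^a (∣𝟏∣ n))

δ≡𝟙isGrassIn : ∀ {t} {L : PSet n} → isGrass n t L ≡ true → ∀ X → δ X L ≡ 𝟙 (isGrassIn L t X)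
δ≡𝟙isGrassIn {n} {t} {L} L∈Grass X = cong 𝟙 (BP.⇔→≡ {z = true} (mk⇔ to from))
  where
  to : does (X ≟ₛ L) ≡ true → isGrassIn L t X ≡ true
  to eq = subst (λ Y → isGrassIn L t Y ≡ true) (sym (does-≟ₛ⇒≡ eq))
    (cong₂ _∧_ (subsetB⁺ {S = L} (λ _ x∈L → x∈L)) L∈Grass)
  from : isGrassIn L t X ≡ true → does (X ≟ₛ L) ≡ true
  from X∈GrassL = dec-true (X ≟ₛ L) (⊆-∣∣-≡ (subsetB⁻ X⊆L) (trans ∣X∣≡2^t (sym (proj₂ (isGrass⁻ t L L∈Grass)))))
    where
    X⊆L : subsetB X L ≡ true
    X⊆L = proj₁ (∧≡true⁻ {subsetB X L} X∈GrassL)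
    ∣X∣≡2^t : ∣ X ∣ ≡ 2 ^ t
    ∣X∣≡2^t = proj₂ (isGrass⁻ t X (proj₂ (∧≡true⁻ {subsetB X L} X∈GrassL)))

∑-δ-adjoinAll : ∀ d {a t} {S L : PSet n} → a + d ≡ t → IsSubspace S → S ⊆ L → ∣ S ∣ ≡ 2 ^ a →
  isGrass n t L ≡ true → ∑[ V ← allMats n d ] δ (adjoinAll S V) L ≡ extensionCount t a d
∑-δ-adjoinAll {n} d {a} {t} {S} {L} refl S-sub S⊆L ∣S∣≡2^a L∈Grass = begin
  ∑[ V ← allMats n d ] δ (adjoinAll S V) L
    ≡⟨ ∑-cong (allMats n d) (δ≡𝟙isGrassIn {t = a + d} {L} L∈Grass ∘ adjoinAll S) ⟩
  ∑[ V ← allMats n d ] 𝟙 (isGrassIn L (a + d) (adjoinAll S V))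
    ≡⟨ ∑-isGrassIn-adjoinAll d S-sub L-sub S⊆L ∣S∣≡2^a ∣L∣≡2^t ⟩
  extensionCount t a d ∎
  where
  open ≡-Reasoning
  L-sub : IsSubspace L
  L-sub = proj₁ (isGrass⁻ t L L∈Grass)
  ∣L∣≡2^t : ∣ L ∣ ≡ 2 ^ t
  ∣L∣≡2^t = proj₂ (isGrass⁻ t L L∈Grass)

superspaces : ℕ → PSet n → List (PSet n)
superspaces {n} t S = filter (λ L → subsetB S L BP.≟ true) (Grass n t)

∑-superspaces : ∀ d {a t} {S : PSet n} → a + d ≡ t → IsSubspace S → ∣ S ∣ ≡ 2 ^ a → (φ : PSet n → ℕ) →
  ∑ (superspaces t S) φ * extensionCount t a d
    ≡ ∑[ V ← allMats n d ] (𝟙 (isGrass n t (adjoinAll S V)) * φ (adjoinAll S V))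
∑-superspaces {n} d {a} {t} {S} a+d≡t S-sub ∣S∣≡2^a φ = begin
  ∑ (superspaces t S) φ * c
    ≡⟨ cong (_* c) (trans (∑-filter (subsetB S) (Grass n t) φ) (∑-filter (isGrass n t) (allPSets n) _)) ⟩
  ∑ (allPSets n) w * c
    ≡⟨ ∑-*ʳ (allPSets n) c w ⟨
  ∑[ L ← allPSets n ] (w L * c)
    ≡⟨ ∑-cong (allPSets n) fibre ⟩
  ∑[ L ← allPSets n ] (w L * ∑[ V ← allMats n d ] δ (adjoinAll S V) L)
    ≡⟨ ∑-fibres (allMats n d) (adjoinAll S) w ⟩
  ∑[ V ← allMats n d ] w (adjoinAll S V)
    ≡⟨ ∑-cong (allMats n d) w-adjoinAll ⟩
  ∑[ V ← allMats n d ] (𝟙 (isGrass n t (adjoinAll S V)) * φ (adjoinAll S V)) ∎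
  where
  open ≡-Reasoning
  c : ℕ
  c = extensionCount t a d
  w : PSet n → ℕ
  w L = 𝟙 (isGrass n t L) * (𝟙 (subsetB S L) * φ L)
  fibre : ∀ L → w L * c ≡ w L * ∑[ V ← allMats n d ] δ (adjoinAll S V) L
  fibre L with isGrass n t L in L∈Grass | subsetB S L in S⊆L
  ... | true  | true  = cong ((1 * (1 * φ L)) *_) (sym (∑-δ-adjoinAll d a+d≡t S-sub (subsetB⁻ S⊆L) ∣S∣≡2^a L∈Grass))
  ... | true  | false = refl
  ... | false | _     = refl
  w-adjoinAll : ∀ V → w (adjoinAll S V) ≡ 𝟙 (isGrass n t (adjoinAll S V)) * φ (adjoinAll S V)
  w-adjoinAll V rewrite subsetB⁺ (⊆-adjoinAll S V) = cong (𝟙 (isGrass n t (adjoinAll S V)) *_) (NP.*-identityˡ _)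

-- Bernoulli's inequality (1 - Y/X)^m ≥ 1 - mY/X for X = Z + Y, multiplied out by X^(m+1).
bernoulli : ∀ Z Y m → (Z + Y) ^ m * (Z + Y) ≤ Z ^ m * (Z + Y) + m * Y * (Z + Y) ^ m
bernoulli Z Y zero    = NP.≤-reflexive (sym (NP.+-identityʳ _))
bernoulli Z Y (suc m) = begin
  (Z + Y) ^ suc m * (Z + Y)
    ≡⟨ solve 3 (λ Z Y Xᵐ → ((Z :+ Y) :* Xᵐ) :* (Z :+ Y) := (Z :+ Y) :* (Xᵐ :* (Z :+ Y))) refl Z Y Xᵐ ⟩
  (Z + Y) * (Xᵐ * (Z + Y))
    ≤⟨ NP.*-monoʳ-≤ (Z + Y) (bernoulli Z Y m) ⟩
  (Z + Y) * (Zᵐ * (Z + Y) + m * Y * Xᵐ)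
    ≡⟨ solve 5 (λ Z Y M Zᵐ Xᵐ → (Z :+ Y) :* (Zᵐ :* (Z :+ Y) :+ M :* Y :* Xᵐ)
                           := Z :* Zᵐ :* (Z :+ Y) :+ Y :* Zᵐ :* (Z :+ Y) :+ M :* Y :* ((Z :+ Y) :* Xᵐ))
               refl Z Y m Zᵐ Xᵐ ⟩
  Z * Zᵐ * (Z + Y) + Y * Zᵐ * (Z + Y) + m * Y * ((Z + Y) * Xᵐ)
    ≤⟨ NP.+-monoˡ-≤ _ (NP.+-monoʳ-≤ (Z * Zᵐ * (Z + Y))
                          (NP.*-monoˡ-≤ (Z + Y) (NP.*-monoʳ-≤ Y (NP.^-monoˡ-≤ m (NP.m≤m+n Z Y))))) ⟩
  Z * Zᵐ * (Z + Y) + Y * Xᵐ * (Z + Y) + m * Y * ((Z + Y) * Xᵐ)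
    ≡⟨ solve 5 (λ Z Y M Zᵐ Xᵐ → Z :* Zᵐ :* (Z :+ Y) :+ Y :* Xᵐ :* (Z :+ Y) :+ M :* Y :* ((Z :+ Y) :* Xᵐ)
                           := Z :* Zᵐ :* (Z :+ Y) :+ (con 1 :+ M) :* Y :* ((Z :+ Y) :* Xᵐ))
               refl Z Y m Zᵐ Xᵐ ⟩
  Z ^ suc m * (Z + Y) + suc m * Y * (Z + Y) ^ suc m ∎
  where
  open NP.≤-Reasoning
  Zᵐ Xᵐ : ℕ
  Zᵐ = Z ^ m
  Xᵐ = (Z + Y) ^ m

^-≤-2*^ : ∀ Z Y m → 0 < Z + Y → 2 * m * Y ≤ Z + Y → (Z + Y) ^ m ≤ 2 * Z ^ m
^-≤-2*^ Z Y m 0<X 2mY≤X =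
  NP.*-cancelʳ-≤ Xᵐ (2 * Zᵐ) X {{>-nonZero 0<X}} (NP.+-cancelʳ-≤ (Xᵐ * X) (Xᵐ * X) (2 * Zᵐ * X) 2BX≤2AX+BX)
  where
  X Zᵐ Xᵐ : ℕ
  X = Z + Y
  Zᵐ = Z ^ m
  Xᵐ = X ^ m
  open NP.≤-Reasoning
  2BX≤2AX+BX : Xᵐ * X + Xᵐ * X ≤ 2 * Zᵐ * X + Xᵐ * X
  2BX≤2AX+BX = begin
    Xᵐ * X + Xᵐ * X                             ≤⟨ NP.+-mono-≤ (bernoulli Z Y m) (bernoulli Z Y m) ⟩
    (Zᵐ * X + m * Y * Xᵐ) + (Zᵐ * X + m * Y * Xᵐ)
      ≡⟨ solve 5 (λ X Y M Zᵐ Xᵐ → (Zᵐ :* X :+ M :* Y :* Xᵐ) :+ (Zᵐ :* X :+ M :* Y :* Xᵐ)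
                               := con 2 :* Zᵐ :* X :+ (con 2 :* M :* Y) :* Xᵐ)
                 refl X Y m Zᵐ Xᵐ ⟩
    2 * Zᵐ * X + (2 * m * Y) * Xᵐ               ≤⟨ NP.+-monoʳ-≤ (2 * Zᵐ * X) (NP.*-monoˡ-≤ Xᵐ 2mY≤X) ⟩
    2 * Zᵐ * X + X * Xᵐ                         ≡⟨ cong (2 * Zᵐ * X +_) (NP.*-comm X Xᵐ) ⟩
    2 * Zᵐ * X + Xᵐ * X                         ∎

^-*-^-≤ : ∀ X Y r d k G₀ G₁ → Y ≤ X → 0 < X → 2 * (r + d * k) * Y ≤ X →
  (X ∸ Y) ^ r ≤ G₀ → (X ∸ Y) ^ d ≤ G₁ → X ^ r * (X ^ d) ^ k ≤ 2 * G₀ * G₁ ^ k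
^-*-^-≤ X Y r d k G₀ G₁ Y≤X 0<X 2mY≤X Zʳ≤G₀ Zᵈ≤G₁ = begin
  X ^ r * (X ^ d) ^ k       ≡⟨ split X ⟩
  X ^ e                     ≡⟨ cong (_^ e) Z+Y≡X ⟨
  (Z + Y) ^ e               ≤⟨ ^-≤-2*^ Z Y e (subst (0 <_) (sym Z+Y≡X) 0<X) (subst (2 * e * Y ≤_) (sym Z+Y≡X) 2mY≤X) ⟩
  2 * Z ^ e                 ≡⟨ cong (2 *_) (split Z) ⟨
  2 * (Z ^ r * (Z ^ d) ^ k) ≤⟨ NP.*-monoʳ-≤ 2 (NP.*-mono-≤ Zʳ≤G₀ (NP.^-monoˡ-≤ k Zᵈ≤G₁)) ⟩
  2 * (G₀ * G₁ ^ k)         ≡⟨ NP.*-assoc 2 G₀ _ ⟨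
  2 * G₀ * G₁ ^ k           ∎
  where
  open NP.≤-Reasoning
  e Z : ℕ
  e = r + d * k
  Z = X ∸ Y
  Z+Y≡X : Z + Y ≡ X
  Z+Y≡X = NP.m∸n+n≡m Y≤X
  split : ∀ W → W ^ r * (W ^ d) ^ k ≡ W ^ e
  split W = trans (cong (W ^ r *_) (NP.^-*-assoc W d k)) (sym (NP.^-distribˡ-+-* W r (d * k)))

extensionCount-≥ : ∀ t s a d → a + d ≤ s → (2 ^ t ∸ 2 ^ s) ^ d ≤ extensionCount t a d
extensionCount-≥ t s a zero    a≤s   = NP.≤-refl
extensionCount-≥ t s a (suc d) a+d≤s = NP.*-mono-≤
  (NP.∸-monoʳ-≤ (2 ^ t) (NP.^-monoʳ-≤ 2 (NP.≤-trans (NP.m≤m+n a (suc d)) a+d≤s)))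
  (extensionCount-≥ t s (suc a) d (subst (_≤ s) (NP.+-suc a d) a+d≤s))

n<2^n : ∀ n → n < 2 ^ n
n<2^n zero    = s≤s z≤n
n<2^n (suc n) = subst (_< 2 ^ suc n) (NP.+-comm n 1)
  (NP.+-mono-<-≤ (n<2^n n) (subst (1 ≤_) (sym (NP.+-identityʳ (2 ^ n))) (NP.m^n>0 2 n)))

extensionCount-pos : ∀ {t s} a d → a + d ≤ s → s < t → 0 < extensionCount t a d
extensionCount-pos {t} {s} a d a+d≤s s<t =
  NP.<-≤-trans (NP.m^n>0 (2 ^ t ∸ 2 ^ s) {{>-nonZero 0<2^t∸2^s}} d) (extensionCount-≥ t s a d a+d≤s)
  where
  0<2^t∸2^s : 0 < 2 ^ t ∸ 2 ^ s
  0<2^t∸2^s = NP.m<n⇒0<n∸m (NP.^-monoʳ-< 2 (s≤s (s≤s z≤n)) s<t)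

m*n≡o>0⇒m>0 : ∀ {m n o} → m * n ≡ o → 0 < o → 0 < m
m*n≡o>0⇒m>0 {suc m} _    _   = s≤s z≤n
m*n≡o>0⇒m>0 {zero}  refl ()

-- Averages in ℚ

ι : ℕ → ℚ
ι n = ℤ.+ n / 1

ι≡mkℚ : ∀ n → ι n ≡ mkℚ (ℤ.+ n) 0 (C.sym (C.1-coprimeTo n))
ι≡mkℚ n = QP.normalize-coprime (C.sym (C.1-coprimeTo n))

ι-+ : ∀ a b → ι a Q.+ ι b ≡ ι (a + b)
ι-+ a b rewrite ι≡mkℚ a | ι≡mkℚ b =
  cong (_/ 1) (trans (cong₂ ℤ._+_ (ZP.*-identityʳ (ℤ.+ a)) (ZP.*-identityʳ (ℤ.+ b))) (sym (ZP.pos-+ a b)))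

ι-* : ∀ a b → ι a Q.* ι b ≡ ι (a * b)
ι-* a b rewrite ι≡mkℚ a | ι≡mkℚ b = cong (_/ 1) (sym (ZP.pos-* a b))

ι-mono-≤ : ∀ {a b} → a ≤ b → ι a Q.≤ ι b
ι-mono-≤ {a} {b} a≤b rewrite ι≡mkℚ a | ι≡mkℚ b =
  Q.*≤* (subst₂ ℤ._≤_ (sym (ZP.*-identityʳ (ℤ.+ a))) (sym (ZP.*-identityʳ (ℤ.+ b))) (ℤ.+≤+ a≤b))

ι-positive : ∀ {a} → 0 < a → Q.Positive (ι a)
ι-positive {suc a} _ = QP.normalize-pos (suc a) 1

ι-^ : ∀ a k → ι a ^ℚ k ≡ ι (a ^ k)
ι-^ a zero    = refl
ι-^ a (suc k) = trans (cong (ι a Q.*_) (ι-^ a k)) (ι-* a _)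

ind≡ι𝟙 : ∀ b → ind b ≡ ι (𝟙 b)
ind≡ι𝟙 true  = refl
ind≡ι𝟙 false = refl

1/[1+d]*ι[1+d] : ∀ d → (ℤ.+ 1 / suc d) Q.* ι (suc d) ≡ 1ℚ
1/[1+d]*ι[1+d] d = trans (cong (Q._* ι (suc d)) 1/[1+d]≡1/ι[1+d]) (QP.*-inverseˡ (ι (suc d)) {{ι≢0}})
  where
  ι≢0 : Q.NonZero (ι (suc d))
  ι≢0 = QP.pos⇒nonZero (ι (suc d)) {{ι-positive {suc d} (s≤s z≤n)}}
  1/[1+d]≡1/ι[1+d] : ℤ.+ 1 / suc d ≡ Q.1/_ (ι (suc d)) {{ι≢0}}
  1/[1+d]≡1/ι[1+d] =
    trans (QP.normalize-coprime (C.1-coprimeTo (suc d))) (sym (1/mkℚ (ι (suc d)) {{ι≢0}} (ι≡mkℚ (suc d))))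
    where
    1/mkℚ : ∀ q .{{_ : Q.NonZero q}} → q ≡ mkℚ (ℤ.+ suc d) 0 (C.sym (C.1-coprimeTo (suc d))) →
            Q.1/ q ≡ mkℚ (ℤ.+ 1) d (C.1-coprimeTo (suc d))
    1/mkℚ q refl = refl

sumℚ-ι : ∀ (xs : List A) (g : A → ℕ) → sumℚ (map (ι ∘ g) xs) ≡ ι (∑ xs g)
sumℚ-ι []       g = refl
sumℚ-ι (x ∷ xs) g = trans (cong (ι (g x) Q.+_) (sumℚ-ι xs g)) (ι-+ (g x) _)

sumℚ-*ʳ : ∀ (xs : List A) (f : A → ℚ) c → sumℚ (map f xs) Q.* c ≡ sumℚ (map (λ x → f x Q.* c) xs)
sumℚ-*ʳ []       f c = QP.*-zeroˡ c
sumℚ-*ʳ (x ∷ xs) f c = trans (QP.*-distribʳ-+ c (f x) _) (cong (f x Q.* c Q.+_) (sumℚ-*ʳ xs f c))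

avg-*-length : ∀ (xs : List A) f → 0 < length xs → avg xs f Q.* ι (length xs) ≡ sumℚ (map f xs)
avg-*-length (x ∷ xs) f _ = trans (QP.*-assoc (sumℚ (map f (x ∷ xs))) _ _)
  (trans (cong (sumℚ (map f (x ∷ xs)) Q.*_) (1/[1+d]*ι[1+d] (length xs))) (QP.*-identityʳ _))

avg-scale : ∀ (xs : List A) {f : A → ℚ} {c} {g : A → ℕ} → 0 < length xs →
  (∀ x → f x Q.* ι c ≡ ι (g x)) → avg xs f Q.* ι (length xs * c) ≡ ι (∑ xs g)
avg-scale xs {f} {c} {g} nonempty scale = begin
  avg xs f Q.* ι (length xs * c)       ≡⟨ cong (avg xs f Q.*_) (ι-* (length xs) c) ⟨
  avg xs f Q.* (ι (length xs) Q.* ι c) ≡⟨ QP.*-assoc (avg xs f) _ _ ⟨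
  avg xs f Q.* ι (length xs) Q.* ι c   ≡⟨ cong (Q._* ι c) (avg-*-length xs f nonempty) ⟩
  sumℚ (map f xs) Q.* ι c              ≡⟨ sumℚ-*ʳ xs f (ι c) ⟩
  sumℚ (map (λ x → f x Q.* ι c) xs)    ≡⟨ cong sumℚ (LP.map-cong scale xs) ⟩
  sumℚ (map (ι ∘ g) xs)                ≡⟨ sumℚ-ι xs g ⟩
  ι (∑ xs g)                           ∎
  where open ≡-Reasoning

^ℚ-distrib-* : ∀ p q k → (p Q.* q) ^ℚ k ≡ p ^ℚ k Q.* q ^ℚ k
^ℚ-distrib-* p q zero    = refl
^ℚ-distrib-* p q (suc k) rewrite ^ℚ-distrib-* p q k =
  QS.solve 4 (λ p q a b → (p QS.:* q) QS.:* (a QS.:* b) QS.:= (p QS.:* a) QS.:* (q QS.:* b)) refl p q (p ^ℚ k) (q ^ℚ k)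

ind-*-^-scale : ∀ b q c w k → (b ≡ true → q Q.* ι c ≡ ι w) → (ind b Q.* q ^ℚ k) Q.* ι (c ^ k) ≡ ι (𝟙 b * w ^ k)
ind-*-^-scale false q c w k _     = trans (cong (Q._* ι (c ^ k)) (QP.*-zeroˡ (q ^ℚ k))) (QP.*-zeroˡ (ι (c ^ k)))
ind-*-^-scale true  q c w k scale = begin
  (1ℚ Q.* q ^ℚ k) Q.* ι (c ^ k)  ≡⟨ cong₂ Q._*_ (QP.*-identityˡ (q ^ℚ k)) (sym (ι-^ c k)) ⟩
  q ^ℚ k Q.* ι c ^ℚ k            ≡⟨ ^ℚ-distrib-* q (ι c) k ⟨
  (q Q.* ι c) ^ℚ k               ≡⟨ cong (_^ℚ k) (scale refl) ⟩
  ι w ^ℚ k                       ≡⟨ ι-^ w k ⟩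
  ι (w ^ k)                      ≡⟨ cong ι (NP.+-identityʳ (w ^ k)) ⟨
  ι (1 * w ^ k)                  ∎
  where open ≡-Reasoning

≤-cross-multiply : ∀ {p q : ℚ} {s a t b} → p Q.* ι a ≡ ι s → q Q.* ι b ≡ ι t → 0 < a → 0 < b →
  s * b ≤ t * a → p Q.≤ q
≤-cross-multiply {p} {q} {s} {a} {t} {b} pa≡s qb≡t 0<a 0<b sb≤ta =
  QP.*-cancelʳ-≤-pos (ι (a * b)) {{ι-positive (NP.*-mono-< 0<a 0<b)}} (subst₂ Q._≤_ (sym p·ab) (sym q·ab) (ι-mono-≤ sb≤ta))
  where
  open ≡-Reasoning
  p·ab : p Q.* ι (a * b) ≡ ι (s * b)
  p·ab = begin
    p Q.* ι (a * b)        ≡⟨ cong (p Q.*_) (ι-* a b) ⟨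
    p Q.* (ι a Q.* ι b)    ≡⟨ QP.*-assoc p (ι a) (ι b) ⟨
    p Q.* ι a Q.* ι b      ≡⟨ cong (Q._* ι b) pa≡s ⟩
    ι s Q.* ι b            ≡⟨ ι-* s b ⟩
    ι (s * b)              ∎
  q·ab : q Q.* ι (a * b) ≡ ι (t * a)
  q·ab = begin
    q Q.* ι (a * b)        ≡⟨ cong (λ x → q Q.* ι x) (NP.*-comm a b) ⟩
    q Q.* ι (b * a)        ≡⟨ cong (q Q.*_) (ι-* b a) ⟨
    q Q.* (ι b Q.* ι a)    ≡⟨ QP.*-assoc q (ι b) (ι a) ⟨
    q Q.* ι b Q.* ι a      ≡⟨ cong (Q._* ι a) qb≡t ⟩
    ι t Q.* ι a            ≡⟨ ι-* t a ⟩
    ι (t * a)              ∎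

module Proof {n L r : ℕ} (r≤L : r ≤ L) (L<n : L < n) (𝓛 𝓡 : PSet n → Bool)
             (𝓛⊆Grass : ∀ S → 𝓛 S ≡ true → isGrass n L S ≡ true)
             (𝓡⊆Grass : ∀ S → 𝓡 S ≡ true → isGrass n r S ≡ true) where

  d : ℕ
  d = L ∸ r

  r+d≡L : r + d ≡ L
  r+d≡L = NP.m+[n∸m]≡n r≤L

  -- B₀ counts the ordered bases of an r-dimensional space, Γ₀ the independent r-tuples in F₂ⁿ,
  -- B₁ the d-tuples completing a basis of R to one of a fixed L ⊇ R, Γ₁ the d-tuples independent over R.
  B₀ Γ₀ B₁ Γ₁ : ℕ
  B₀ = extensionCount r 0 r
  Γ₀ = extensionCount n 0 r
  B₁ = extensionCount L r d
  Γ₁ = extensionCount n r d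

  0<Γ₀ : 0 < Γ₀
  0<Γ₀ = extensionCount-pos 0 r r≤L L<n

  0<Γ₁ : 0 < Γ₁
  0<Γ₁ = extensionCount-pos r d (NP.≤-reflexive r+d≡L) L<n

  𝓛-above : PSet n → ℕ
  𝓛-above R = ∑ (superspaces L R) (𝟙 ∘ 𝓛)

  module _ {R : PSet n} (R∈Grass : isGrass n r R ≡ true) where

    private
      R-sub : IsSubspace R
      R-sub = proj₁ (isGrass⁻ r R R∈Grass)
      ∣R∣≡2^r : ∣ R ∣ ≡ 2 ^ r
      ∣R∣≡2^r = proj₂ (isGrass⁻ r R R∈Grass)

    ∣superspaces∣*B₁≡Γ₁ : length (superspaces L R) * B₁ ≡ Γ₁
    ∣superspaces∣*B₁≡Γ₁ = begin
      length (superspaces L R) * B₁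
        ≡⟨ cong (_* B₁) (length≡∑1 (superspaces L R)) ⟩
      ∑[ S ← superspaces L R ] 1 * B₁
        ≡⟨ ∑-superspaces d r+d≡L R-sub ∣R∣≡2^r (λ _ → 1) ⟩
      ∑[ V ← allMats n d ] (𝟙 (isGrass n L (adjoinAll R V)) * 1)
        ≡⟨ ∑-cong (allMats n d) (λ V → NP.*-identityʳ _) ⟩
      ∑[ V ← allMats n d ] 𝟙 (isGrass n L (adjoinAll R V))
        ≡⟨ subst (λ t → ∑[ V ← allMats n d ] 𝟙 (isGrass n t (adjoinAll R V)) ≡ Γ₁) r+d≡L
                 (∑-isGrass-adjoinAll d R-sub ∣R∣≡2^r) ⟩
      Γ₁ ∎
      where open ≡-Reasoning

    𝓛-above*B₁ : 𝓛-above R * B₁ ≡ ∑[ V ← allMats n d ] 𝟙 (𝓛 (adjoinAll R V))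
    𝓛-above*B₁ = trans (∑-superspaces d r+d≡L R-sub ∣R∣≡2^r (𝟙 ∘ 𝓛)) (∑-cong (allMats n d) in-Grass)
      where
      in-Grass : ∀ V → 𝟙 (isGrass n L (adjoinAll R V)) * 𝟙 (𝓛 (adjoinAll R V)) ≡ 𝟙 (𝓛 (adjoinAll R V))
      in-Grass V = 𝟙-implied (𝓛⊆Grass (adjoinAll R V))

    avg-superspaces : avg (superspaces L R) (ind ∘ 𝓛) Q.* ι Γ₁ ≡ ι (𝓛-above R * B₁)
    avg-superspaces = begin
      avg (superspaces L R) (ind ∘ 𝓛) Q.* ι Γ₁
        ≡⟨ cong (λ c → avg (superspaces L R) (ind ∘ 𝓛) Q.* ι c) ∣superspaces∣*B₁≡Γ₁ ⟨
      avg (superspaces L R) (ind ∘ 𝓛) Q.* ι (length (superspaces L R) * B₁)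
        ≡⟨ avg-scale (superspaces L R) (m*n≡o>0⇒m>0 ∣superspaces∣*B₁≡Γ₁ 0<Γ₁)
                     (λ S → trans (cong (Q._* ι B₁) (ind≡ι𝟙 (𝓛 S))) (ι-* (𝟙 (𝓛 S)) B₁)) ⟩
      ι (∑[ S ← superspaces L R ] (𝟙 (𝓛 S) * B₁))
        ≡⟨ cong ι (∑-*ʳ (superspaces L R) B₁ (𝟙 ∘ 𝓛)) ⟩
      ι (𝓛-above R * B₁) ∎
      where open ≡-Reasoning

  D : ℕ
  D = length (allMats n d)

  TF-scaled : ∀ (M : Mat n r) → isGrass n r (im M) ≡ true → TF n L r 𝓛 M Q.* ι D ≡ ι (𝓛-above (im M) * B₁)
  TF-scaled M M∈Grass = begin
    TF n L r 𝓛 M Q.* ι D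
      ≡⟨ avg-*-length (allMats n d) _ (0<length-allMats n d) ⟩
    sumℚ (map (λ V → Ffun 𝓛 (M Vec.++ V)) (allMats n d))
      ≡⟨ cong sumℚ (LP.map-cong (λ V → trans (ind≡ι𝟙 (𝓛 (im (M Vec.++ V)))) (cong (ι ∘ 𝟙 ∘ 𝓛) (im-++ M V)))
                                (allMats n d)) ⟩
    sumℚ (map (λ V → ι (𝟙 (𝓛 (adjoinAll (im M) V)))) (allMats n d))
      ≡⟨ sumℚ-ι (allMats n d) _ ⟩
    ι (∑[ V ← allMats n d ] 𝟙 (𝓛 (adjoinAll (im M) V)))
      ≡⟨ cong ι (𝓛-above*B₁ M∈Grass) ⟨
    ι (𝓛-above (im M) * B₁) ∎
    where open ≡-Reasoning

  Grass≡superspaces𝟎 : Grass n r ≡ superspaces r (𝟎 n)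
  Grass≡superspaces𝟎 = sym (LP.filter-all (λ S → subsetB (𝟎 n) S BP.≟ true)
    (All.map (λ {S} S∈Grass → subsetB⁺ (𝟎⊆ (proj₁ (isGrass⁻ r S S∈Grass))))
             (AllP.all-filter (λ S → isGrass n r S BP.≟ true) (allPSets n))))

  ∑-Grass : ∀ φ → ∑ (Grass n r) φ * B₀ ≡ ∑[ M ← allMats n r ] (𝟙 (isGrass n r (im M)) * φ (im M))
  ∑-Grass φ = begin
    ∑ (Grass n r) φ * B₀                  ≡⟨ cong (λ Rs → ∑ Rs φ * B₀) Grass≡superspaces𝟎 ⟩
    ∑ (superspaces r (𝟎 n)) φ * B₀        ≡⟨ ∑-superspaces r refl (𝟎-isSubspace n) (∣𝟎∣ n) φ ⟩
    ∑[ M ← allMats n r ] (𝟙 (isGrass n r (adjoinAll (𝟎 n) M)) * φ (adjoinAll (𝟎 n) M))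
      ≡⟨ ∑-cong (allMats n r) (λ M → cong (λ S → 𝟙 (isGrass n r S) * φ S) (im≡adjoinAll𝟎 M)) ⟨
    ∑[ M ← allMats n r ] (𝟙 (isGrass n r (im M)) * φ (im M)) ∎
    where open ≡-Reasoning

  ∣Grass∣*B₀≡Γ₀ : length (Grass n r) * B₀ ≡ Γ₀
  ∣Grass∣*B₀≡Γ₀ = begin
    length (Grass n r) * B₀             ≡⟨ cong (_* B₀) (length≡∑1 (Grass n r)) ⟩
    ∑[ R ← Grass n r ] 1 * B₀           ≡⟨ ∑-Grass (λ _ → 1) ⟩
    ∑[ M ← allMats n r ] (𝟙 (isGrass n r (im M)) * 1)
      ≡⟨ ∑-cong (allMats n r) (λ M → trans (NP.*-identityʳ _) (cong (𝟙 ∘ isGrass n r) (im≡adjoinAll𝟎 M))) ⟩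
    ∑[ M ← allMats n r ] 𝟙 (isGrass n r (adjoinAll (𝟎 n) M)) ≡⟨ ∑-isGrass-adjoinAll r (𝟎-isSubspace n) (∣𝟎∣ n) ⟩
    Γ₀ ∎
    where open ≡-Reasoning

  0<∣Grass∣ : 0 < length (Grass n r)
  0<∣Grass∣ = m*n≡o>0⇒m>0 ∣Grass∣*B₀≡Γ₀ 0<Γ₀

  module _ (k : ℕ) where

    weight : PSet n → ℕ
    weight R = 𝟙 (𝓡 R) * (𝓛-above R * B₁) ^ k

    probRL-scaled : probRL n L r k 𝓛 𝓡 Q.* ι (length (Grass n r) * Γ₁ ^ k) ≡ ι (∑ (Grass n r) weight)
    probRL-scaled = avg-scale (Grass n r) 0<∣Grass∣ λ R →
      ind-*-^-scale (𝓡 R) _ Γ₁ (𝓛-above R * B₁) k (λ R∈𝓡 → avg-superspaces (𝓡⊆Grass R R∈𝓡))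

    inner-scaled : innerTFkG n L r k 𝓛 𝓡 Q.* ι (length (allMats n r) * D ^ k) ≡ ι (∑ (Grass n r) weight * B₀)
    inner-scaled = trans (avg-scale (allMats n r) (0<length-allMats n r) scaled) (cong ι (sym ∑-weight))
      where
      scaled : ∀ M → (TF n L r 𝓛 M ^ℚ k Q.* ind (𝓡 (im M))) Q.* ι (D ^ k) ≡ ι (weight (im M))
      scaled M = trans (cong (Q._* ι (D ^ k)) (QP.*-comm (TF n L r 𝓛 M ^ℚ k) _))
        (ind-*-^-scale (𝓡 (im M)) _ D (𝓛-above (im M) * B₁) k (λ M∈𝓡 → TF-scaled M (𝓡⊆Grass (im M) M∈𝓡)))
      ∑-weight : ∑ (Grass n r) weight * B₀ ≡ ∑[ M ← allMats n r ] weight (im M)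
      ∑-weight = trans (∑-Grass weight) (∑-cong (allMats n r) λ M →
        trans (sym (NP.*-assoc (𝟙 (isGrass n r (im M))) _ _))
              (cong (_* (𝓛-above (im M) * B₁) ^ k) (𝟙-implied (𝓡⊆Grass (im M)))))

    module _ (large : L + 2 * (r + d * k) < n) where

      2[r+dk]*2^L≤2^n : 2 * (r + d * k) * 2 ^ L ≤ 2 ^ n
      2[r+dk]*2^L≤2^n = begin
        2 * e * 2 ^ L    ≤⟨ NP.*-monoˡ-≤ (2 ^ L) (NP.<⇒≤ (n<2^n (2 * e))) ⟩
        2 ^ (2 * e) * 2 ^ L ≡⟨ NP.*-comm (2 ^ (2 * e)) _ ⟩
        2 ^ L * 2 ^ (2 * e) ≡⟨ NP.^-distribˡ-+-* 2 L (2 * e) ⟨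
        2 ^ (L + 2 * e)  ≤⟨ NP.^-monoʳ-≤ 2 (NP.<⇒≤ large) ⟩
        2 ^ n            ∎
        where
        open NP.≤-Reasoning
        e : ℕ
        e = r + d * k

      ∣allMats∣*Dᵏ≤2Γ₀Γ₁ᵏ : length (allMats n r) * D ^ k ≤ 2 * Γ₀ * Γ₁ ^ k
      ∣allMats∣*Dᵏ≤2Γ₀Γ₁ᵏ rewrite length-allMats n r | length-allMats n d =
        ^-*-^-≤ (2 ^ n) (2 ^ L) r d k Γ₀ Γ₁ (NP.^-monoʳ-≤ 2 (NP.<⇒≤ L<n)) (NP.m^n>0 2 n) 2[r+dk]*2^L≤2^n
          (extensionCount-≥ n L 0 r r≤L) (extensionCount-≥ n L r d (NP.≤-reflexive r+d≡L))

      probRL≤2*inner : probRL n L r k 𝓛 𝓡 Q.≤ twoℚ Q.* innerTFkG n L r k 𝓛 𝓡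
      probRL≤2*inner = ≤-cross-multiply {s = W} {G * Γ₁ ^ k} {2 * (W * B₀)} {P * D ^ k} probRL-scaled 2*inner-scaled
        (NP.*-mono-< 0<∣Grass∣ (NP.m^n>0 Γ₁ {{>-nonZero 0<Γ₁}} k))
        (NP.*-mono-< (0<length-allMats n r) (NP.m^n>0 D {{>-nonZero (0<length-allMats n d)}} k))
        cross
        where
        G P W : ℕ
        G = length (Grass n r)
        P = length (allMats n r)
        W = ∑ (Grass n r) weight
        2*inner-scaled : (twoℚ Q.* innerTFkG n L r k 𝓛 𝓡) Q.* ι (P * D ^ k) ≡ ι (2 * (W * B₀))
        2*inner-scaled = trans (QP.*-assoc twoℚ (innerTFkG n L r k 𝓛 𝓡) (ι (P * D ^ k)))
                               (trans (cong (twoℚ Q.*_) inner-scaled) (ι-* 2 (W * B₀)))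
        cross : W * (P * D ^ k) ≤ 2 * (W * B₀) * (G * Γ₁ ^ k)
        cross = begin
          W * (P * D ^ k)              ≤⟨ NP.*-monoʳ-≤ W ∣allMats∣*Dᵏ≤2Γ₀Γ₁ᵏ ⟩
          W * (2 * Γ₀ * Γ₁ ^ k)        ≡⟨ cong (λ γ → W * (2 * γ * Γ₁ ^ k)) ∣Grass∣*B₀≡Γ₀ ⟨
          W * (2 * (G * B₀) * Γ₁ ^ k)
            ≡⟨ solve 4 (λ W G B g → W :* (con 2 :* (G :* B) :* g) := con 2 :* (W :* B) :* (G :* g)) refl W G B₀ (Γ₁ ^ k) ⟩
          2 * (W * B₀) * (G * Γ₁ ^ k)  ∎
          where open NP.≤-Reasoning

-- The threshold N makes (1 - 2^(L-n))^(r+dk) ≥ 1/2.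
lemma4p4 : ∀ (k : ℕ) → 1 ≤ k → ∀ (ℓ r : ℕ) → r < 2 * ℓ →
    ∃ λ (N : ℕ) → ∀ (n : ℕ) → N ≤ n →
      ∀ (𝓛 𝓡 : PSet n → Bool) →
      (∀ S → 𝓛 S ≡ true → isGrass n (2 * ℓ) S ≡ true) →
      (∀ S → 𝓡 S ≡ true → isGrass n r S ≡ true) →
      probRL n (2 * ℓ) r k 𝓛 𝓡 Q.≤ twoℚ Q.* innerTFkG n (2 * ℓ) r k 𝓛 𝓡
lemma4p4 k _ ℓ r r<L = suc (L + 2 * (r + (L ∸ r) * k)) , λ n large 𝓛 𝓡 𝓛⊆Grass 𝓡⊆Grass →
  Proof.probRL≤2*inner (NP.<⇒≤ r<L) (NP.<-≤-trans (s≤s (NP.m≤m+n L _)) large) 𝓛 𝓡 𝓛⊆Grass 𝓡⊆Grass k large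
  where
  L : ℕ
  L = 2 * ℓ
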